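{- Let $m \geq 3$ and $S$ be a minimal zero-sum sequence with a support of size 3, $\{s_1, s_2, s_3 \} \subseteq \{ -m,\dots,m\}^2$, such that $\mathsf{D}^{(3)} (\{ -m,\dots,m\}^2) = |S|$. Let $A$ be the matrix, the $i$-th column of which is $s_i$ ($i=1,2,3$). Then $A$ is analogous to a matrix $B$ belonging to $\mathcal{C}'$ and $$ \mathsf{D}^{(3)} (\{ -m,\dots,m\}^2) = \sum_{i=1}^3 | \det B_i |. $$
   Context: A minimal zero-sum sequence is an unordered sequence summing to $0$ with no non-empty proper subsequence summing to $0$; $|S|$ is its length. $\mathsf{D}^{(3)}(X)$ is the maximal length of a minimal zero-sum sequence over $X$ with support (set of distinct elements) of size exactly $3$. $\{ -m,\dots,m\}$ denotes the set of integers $i$ with $-m\le i\le m$. For a $2\times 3$ matrix $A$ with coefficients in $\{ -m,\dots,m\}$, $A_i$ is the $2\times 2$ submatrix obtained by deleting the $i$-th column, and $\Delta(A)=\gcd(\det A_1,\det A_2,\det A_3)$. $\mathcal{C}$ is the set of such matrices with $\det A_1,\det A_2,\det A_3\neq 0$ and $\Delta(A)=1$; $\mathcal{C}'$ is the subset of $\mathcal{C}$ of matrices with sign pattern $\begin{pmatrix}+&-&+\\+&+&-\end{pmatrix}$ (entries in positions marked $+$ are $\ge 0$, those marked $-$ are $\le 0$). Two such matrices are analogous if one can be obtained from the other by permuting columns and applying one of the eight symmetries of the square (generated by $(x,y)\mapsto(-x,y)$ and $(x,y)\mapsto(y,x)$) to all columns. -}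

module Defs where

open import Data.Nat using (ℕ; suc) renaming (_≤_ to _≤ℕ_; _+_ to _+ℕ_)
open import Data.Integer using (ℤ; +_; -_; _+_; _-_; _*_; _≤_; ∣_∣)
open import Data.Integer.GCD using (gcd)
open import Data.Bool using (Bool; true; false)
open import Data.Fin using (Fin; zero; suc)
open import Data.Fin.Permutation using (Permutation′)
open import Function.Bundles using (Inverse)
open import Data.Product using (_×_; _,_; proj₁; proj₂; ∃; ∃-syntax; Σ-syntax)
open import Function.Definitions using (Injective)
open import Relation.Binary.PropositionalEquality using (_≡_; _≢_)
open import Relation.Nullary using (¬_)

Pt : Set
Pt = ℤ × ℤ

0ᵖ : Pt
0ᵖ = (+ 0 , + 0)

_+ᵖ_ : Pt → Pt → Pt
(a , b) +ᵖ (c , d) = (a + c , b + d)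

_·ᵖ_ : ℕ → Pt → Pt
k ·ᵖ (a , b) = ((+ k) * a , (+ k) * b)

InRange : ℕ → ℤ → Set
InRange m x = (- (+ m)) ≤ x × x ≤ (+ m)

InBox : ℕ → Pt → Set
InBox m (a , b) = InRange m a × InRange m b

-- A sequence (multiset) over ℤ² whose support has size exactly 3:
-- three pairwise distinct points with multiplicities ≥ 1.
record Seq3 : Set where
  field
    pt   : Fin 3 → Pt
    mult : Fin 3 → ℕ
    distinct : Injective _≡_ _≡_ pt
    multPos  : ∀ i → 1 ≤ℕ mult i
open Seq3 public

len : Seq3 → ℕ
len S = mult S zero +ℕ mult S (suc zero) +ℕ mult S (suc (suc zero))

wsum : (Fin 3 → ℕ) → (Fin 3 → Pt) → Pt
wsum j p = (j zero ·ᵖ p zero) +ᵖ ((j (suc zero) ·ᵖ p (suc zero)) +ᵖ (j (suc (suc zero)) ·ᵖ p (suc (suc zero))))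

Over : ℕ → Seq3 → Set
Over m S = ∀ i → InBox m (pt S i)

-- minimal zero-sum: sums to 0, and no non-empty proper subsequence
-- (given by sub-multiplicities j ≤ mult) sums to 0
MinZeroSum : Seq3 → Set
MinZeroSum S =
  wsum (mult S) (pt S) ≡ 0ᵖ ×
  (∀ (j : Fin 3 → ℕ) → (∀ i → j i ≤ℕ mult S i) →
     (∃[ i ] 1 ≤ℕ j i) → (∃[ i ] j i ≢ mult S i) →
     ¬ (wsum j (pt S) ≡ 0ᵖ))

IsD3 : ℕ → ℕ → Set
IsD3 m n =
  (∃[ T ] (Over m T × MinZeroSum T × len T ≡ n)) ×
  (∀ T → Over m T → MinZeroSum T → len T ≤ℕ n)

-- 2×3 matrices, given by their three columns
Mat : Set
Mat = Fin 3 → Pt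

det2 : Pt → Pt → ℤ
det2 (a , b) (c , d) = a * d - c * b

detDel : Mat → Fin 3 → ℤ
detDel A zero = det2 (A (suc zero)) (A (suc (suc zero)))
detDel A (suc zero) = det2 (A zero) (A (suc (suc zero)))
detDel A (suc (suc zero)) = det2 (A zero) (A (suc zero))

Δ : Mat → ℤ
Δ A = gcd (gcd (detDel A zero) (detDel A (suc zero))) (detDel A (suc (suc zero)))

inC : ℕ → Mat → Set
inC m A = (∀ i → InBox m (A i)) × (∀ i → detDel A i ≢ + 0) × Δ A ≡ + 1

inC′ : ℕ → Mat → Set
inC′ m A =
  inC m A ×
  ((+ 0 ≤ proj₁ (A zero)) × (proj₁ (A (suc zero)) ≤ + 0) × (+ 0 ≤ proj₁ (A (suc (suc zero))))) ×
  ((+ 0 ≤ proj₂ (A zero)) × (+ 0 ≤ proj₂ (A (suc zero))) × (proj₂ (A (suc (suc zero))) ≤ + 0))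

-- the eight symmetries of the square: optional swap (x,y) ↦ (y,x),
-- followed by optional negation of each coordinate
negIf : Bool → ℤ → ℤ
negIf true x = - x
negIf false x = x

swapIf : Bool → Pt → Pt
swapIf true (a , b) = (b , a)
swapIf false p = p

sym : Bool → Bool → Bool → Pt → Pt
sym s nx ny p = (negIf nx (proj₁ (swapIf s p)) , negIf ny (proj₂ (swapIf s p)))

Analogous : Mat → Mat → Set
Analogous A B =
  Σ[ σ ∈ Permutation′ 3 ] ∃[ s ] ∃[ nx ] ∃[ ny ]
    (∀ (i : Fin 3) → B i ≡ sym s nx ny (A (Inverse.to σ i)))

sumAbsDet : Mat → ℕ
sumAbsDet B = ∣ detDel B zero ∣ +ℕ ∣ detDel B (suc zero) ∣ +ℕ ∣ detDel B (suc (suc zero)) ∣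

-- Write a_i for the multiplicity of the column p_i of A and D_i = det A_i.  Cramer's rule
-- applied to Σ a_i p_i = 0 gives a_1 D_0 = -a_0 D_1 and a_2 D_0 = a_0 D_2, and minimality
-- makes gcd(a_0, a_1, a_2) = 1, so |D_i| = t·a_i for a single t ∈ ℕ.  Extremality compares
-- |S| with the minimal zero-sum sequence (m, m-1)^{2m-1} (-m, m-1)^{2m²-2m+1} (m-1, -m)^{2m²-2m}
-- of length 2m(2m-1).  If t = 0 the columns are collinear and S is in effect a
-- one-dimensional sequence, of length at most 2m²-2; if t ≥ 2 then 2|S| ≤ Σ|D_i| ≤ 6m².
-- Both contradict extremality when m ≥ 3, so t = 1 and |S| = Σ|D_i|.  The symmetry that
-- normalises A is read off the signs of its six entries, by an exhaustive check of the 3⁶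
-- sign patterns.  This fails only if all first (or all second) coordinates have one sign,
-- which a zero sum with D_2 ≠ 0 excludes, or if two columns lie in one open quadrant; then
-- |S| = |D_0 - D_1 + D_2|, twice the area of the triangle p_0 p_1 p_2, is at most 3m²-2m-1,
-- again too short.

module Submission where

open import Defs
open import Data.Nat using (ℕ; _≤_)
open import Data.Product using (_×_; ∃-syntax)
open import Relation.Binary.PropositionalEquality using (_≡_)

open import Data.Bool using (Bool; true; false; T; _∧_; _∨_)
open import Data.Bool.ListAction using (all; any)
open import Data.Bool.Properties using (T-∧; T-∨)
open import Data.Empty using (⊥; ⊥-elim)
open import Data.Fin using (Fin; zero; suc)
open import Data.Fin.Permutation using (Permutation′; permutation)
open import Data.List using (List; []; _∷_; cartesianProduct)
open import Data.List.Membership.Propositional using (_∈_)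
open import Data.List.Membership.Propositional.Properties using (∈-cartesianProduct⁺)
open import Data.List.Relation.Unary.All as All using ()
open import Data.List.Relation.Unary.All.Properties using (all⁺)
open import Data.List.Relation.Unary.Any using (here; there; satisfied)
open import Data.List.Relation.Unary.Any.Properties using (any⁻)
import Data.Nat as ℕ
open import Data.Nat.Divisibility using (_∣_; ∣-trans)
open import Data.Nat.GCD using (gcd; gcd[m,n]∣m; gcd[m,n]∣n)
open import Data.Product using (_,_; proj₁; proj₂; uncurry)
open import Data.Sum using (_⊎_; inj₁; inj₂; [_,_]′)
open import Function using (_∘_; case_of_)
open import Function.Bundles using (Equivalence)
open import Relation.Binary.PropositionalEquality as ≡ using (_≢_; refl; cong; cong₂; subst; trans)
open import Relation.Nullary using (¬_; yes; no)

pattern 0F = zero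
pattern 1F = suc zero
pattern 2F = suc (suc zero)

⟨_,_,_⟩ : ∀ {a} {A : Set a} → A → A → A → Fin 3 → A
⟨ x , y , z ⟩ 0F = x
⟨ x , y , z ⟩ 1F = y
⟨ x , y , z ⟩ 2F = z

fin3 : ∀ {p} {P : Fin 3 → Set p} → P 0F → P 1F → P 2F → ∀ i → P i
fin3 p₀ p₁ p₂ 0F = p₀
fin3 p₀ p₁ p₂ 1F = p₁
fin3 p₀ p₁ p₂ 2F = p₂

cong₃ : ∀ {A B C D : Set} (f : A → B → C → D) {x x′ y y′ z z′} →
        x ≡ x′ → y ≡ y′ → z ≡ z′ → f x y z ≡ f x′ y′ z′
cong₃ f refl refl refl = refl

1≤⇒0≢ : ∀ {k} → 1 ≤ k → 0 ≢ k
1≤⇒0≢ () refl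

gcd₃ : (Fin 3 → ℕ) → ℕ
gcd₃ f = gcd (gcd (f 0F) (f 1F)) (f 2F)

gcd₃∣ : ∀ f i → gcd₃ f ∣ f i
gcd₃∣ f 0F = ∣-trans (gcd[m,n]∣m (gcd (f 0F) (f 1F)) (f 2F)) (gcd[m,n]∣m (f 0F) (f 1F))
gcd₃∣ f 1F = ∣-trans (gcd[m,n]∣m (gcd (f 0F) (f 1F)) (f 2F)) (gcd[m,n]∣n (f 0F) (f 1F))
gcd₃∣ f 2F = gcd[m,n]∣n (gcd (f 0F) (f 1F)) (f 2F)

sum₃ : (Fin 3 → ℕ) → ℕ
sum₃ a = a 0F ℕ.+ a 1F ℕ.+ a 2F

module Perm3 where
  open import Data.Nat.Properties using (+-commutativeSemigroup)
  open import Algebra.Properties.CommutativeSemigroup +-commutativeSemigroup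

  data Perm3 : Set where
    p012 p021 p102 p120 p201 p210 : Perm3

  all-Perm3 : List Perm3
  all-Perm3 = p012 ∷ p021 ∷ p102 ∷ p120 ∷ p201 ∷ p210 ∷ []

  apply : Perm3 → Fin 3 → Fin 3
  apply p012 = ⟨ 0F , 1F , 2F ⟩
  apply p021 = ⟨ 0F , 2F , 1F ⟩
  apply p102 = ⟨ 1F , 0F , 2F ⟩
  apply p120 = ⟨ 1F , 2F , 0F ⟩
  apply p201 = ⟨ 2F , 0F , 1F ⟩
  apply p210 = ⟨ 2F , 1F , 0F ⟩

  inverse : Perm3 → Perm3
  inverse p120 = p201
  inverse p201 = p120
  inverse k    = k

  apply-inverseˡ : ∀ k i → apply (inverse k) (apply k i) ≡ i
  apply-inverseˡ p012 = fin3 refl refl refl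
  apply-inverseˡ p021 = fin3 refl refl refl
  apply-inverseˡ p102 = fin3 refl refl refl
  apply-inverseˡ p120 = fin3 refl refl refl
  apply-inverseˡ p201 = fin3 refl refl refl
  apply-inverseˡ p210 = fin3 refl refl refl

  apply-inverseʳ : ∀ k i → apply k (apply (inverse k) i) ≡ i
  apply-inverseʳ p012 = fin3 refl refl refl
  apply-inverseʳ p021 = fin3 refl refl refl
  apply-inverseʳ p102 = fin3 refl refl refl
  apply-inverseʳ p120 = fin3 refl refl refl
  apply-inverseʳ p201 = fin3 refl refl refl
  apply-inverseʳ p210 = fin3 refl refl refl

  toPermutation : Perm3 → Permutation′ 3
  toPermutation k = permutation (apply k) (apply (inverse k)) (apply-inverseʳ k) (apply-inverseˡ k)

  sum₃-apply : ∀ k a → sum₃ (a ∘ apply k) ≡ sum₃ a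
  sum₃-apply p012 a = refl
  sum₃-apply p021 a = xy∙z≈xz∙y (a 0F) (a 2F) (a 1F)
  sum₃-apply p102 a = xy∙z≈yx∙z (a 1F) (a 0F) (a 2F)
  sum₃-apply p120 a = xy∙z≈zx∙y (a 1F) (a 2F) (a 0F)
  sum₃-apply p201 a = xy∙z≈yz∙x (a 2F) (a 0F) (a 1F)
  sum₃-apply p210 a = xy∙z≈zy∙x (a 2F) (a 1F) (a 0F)

open Perm3 using (Perm3; all-Perm3; apply; inverse; apply-inverseʳ; toPermutation; sum₃-apply)

module Signs where

  data Sign : Set where
    neg zer pos : Sign

  SignPair : Set
  SignPair = Sign × Sign

  Config : Set
  Config = SignPair × SignPair × SignPair

  columns : Config → Fin 3 → SignPair
  columns (u , v , w) = ⟨ u , v , w ⟩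

  opposite : Sign → Sign
  opposite neg = pos
  opposite zer = zer
  opposite pos = neg

  negIfˢ : Bool → Sign → Sign
  negIfˢ true  = opposite
  negIfˢ false s = s

  swapIfˢ : Bool → SignPair → SignPair
  swapIfˢ true (a , b) = (b , a)
  swapIfˢ false u = u

  symˢ : Bool → Bool → Bool → SignPair → SignPair
  symˢ s nx ny u = (negIfˢ nx (proj₁ (swapIfˢ s u)) , negIfˢ ny (proj₂ (swapIfˢ s u)))

  nonNeg nonPos : Sign → Bool
  nonNeg neg = false
  nonNeg _   = true
  nonPos pos = false
  nonPos _   = true

  sameStrictSign : Sign → Sign → Bool
  sameStrictSign neg neg = true
  sameStrictSign pos pos = true
  sameStrictSign _   _   = false

  sameOpenQuadrant : SignPair → SignPair → Bool
  sameOpenQuadrant (a , b) (c , d) = sameStrictSign a c ∧ sameStrictSign b d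

  oneSigned : (Sign → Bool) → (SignPair → Sign) → Config → Bool
  oneSigned P coord (u , v , w) = P (coord u) ∧ P (coord v) ∧ P (coord w)

  oneSignedCoordinate : (SignPair → Sign) → Config → Bool
  oneSignedCoordinate coord c = oneSigned nonNeg coord c ∨ oneSigned nonPos coord c

  twoInOneQuadrant : Config → Bool
  twoInOneQuadrant (u , v , w) = sameOpenQuadrant u v ∨ sameOpenQuadrant u w ∨ sameOpenQuadrant v w

  degenerate : Config → Bool
  degenerate c = oneSignedCoordinate proj₁ c ∨ oneSignedCoordinate proj₂ c ∨ twoInOneQuadrant c

  patternC′ : (Fin 3 → SignPair) → Bool
  patternC′ b =
    nonNeg (proj₁ (b 0F)) ∧ nonPos (proj₁ (b 1F)) ∧ nonNeg (proj₁ (b 2F)) ∧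
    nonNeg (proj₂ (b 0F)) ∧ nonNeg (proj₂ (b 1F)) ∧ nonPos (proj₂ (b 2F))

  Normalisation : Set
  Normalisation = Perm3 × Bool × Bool × Bool

  normalise : Normalisation → (Fin 3 → SignPair) → Fin 3 → SignPair
  normalise (k , s , nx , ny) c i = symˢ s nx ny (c (apply k i))

  normalisations : List Normalisation
  normalisations = cartesianProduct all-Perm3 (cartesianProduct bools (cartesianProduct bools bools))
    where
    bools : List Bool
    bools = true ∷ false ∷ []

  normalisable : Config → Bool
  normalisable c = any (λ d → patternC′ (normalise d (columns c))) normalisations

  signs : List Sign
  signs = neg ∷ zer ∷ pos ∷ []

  ∈-signs : ∀ s → s ∈ signs
  ∈-signs neg = here refl
  ∈-signs zer = there (here refl)
  ∈-signs pos = there (there (here refl))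

  signPairs : List SignPair
  signPairs = cartesianProduct signs signs

  ∈-signPairs : ∀ u → u ∈ signPairs
  ∈-signPairs (a , b) = ∈-cartesianProduct⁺ (∈-signs a) (∈-signs b)

  configs : List Config
  configs = cartesianProduct signPairs (cartesianProduct signPairs signPairs)

  ∈-configs : ∀ c → c ∈ configs
  ∈-configs (u , v , w) = ∈-cartesianProduct⁺ (∈-signPairs u) (∈-cartesianProduct⁺ (∈-signPairs v) (∈-signPairs w))

  -- Decided by evaluating `all` over the 3⁶ configurations.  Opaque, since unfolding that
  -- evaluation during conversion checking exhausts memory.
  opaque
    degenerate-or-normalisable : ∀ c → T (degenerate c) ⊎ T (normalisable c)
    degenerate-or-normalisable c = Equivalence.to T-∨
      (All.lookup (all⁺ (λ c → degenerate c ∨ normalisable c) configs _) (∈-configs c))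

module Bounds where
  open import Data.Nat
  open import Data.Nat.Properties
  open import Data.Nat.Tactic.RingSolver using (solve-∀)

  -- The box is {-m,…,m} with m = n + 1; all bounds are stated in n except detBound, which takes m.

  oneDimBound : ℕ → ℕ
  oneDimBound n = (n * suc n + n * suc n) + (n + n)

  sameQuadrantBound : ℕ → ℕ
  sameQuadrantBound n = (n + n * suc n) + (n * suc n + suc n * n)

  detBound : ℕ → ℕ
  detBound m = m * m + m * m

  extremalLength : ℕ → ℕ
  extremalLength n = suc n * (4 * n + 2)

  <-by : ∀ {a b} c → suc (a + c) ≡ b → a < b
  <-by {a} c refl = s≤s (m≤m+n a c)

  oneDimBound<extremalLength : ∀ n → oneDimBound n < extremalLength n
  oneDimBound<extremalLength n = <-by (n * n * 2 + n * 2 + 1) (identity n)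
    where
    identity : ∀ n → suc ((n * suc n + n * suc n) + (n + n) + (n * n * 2 + n * 2 + 1)) ≡ suc n * (4 * n + 2)
    identity = solve-∀

  sameQuadrantBound<extremalLength : ∀ n → sameQuadrantBound n < extremalLength n
  sameQuadrantBound<extremalLength n = <-by (n * n + n * 2 + 1) (identity n)
    where
    identity : ∀ n → suc ((n + n * suc n) + (n * suc n + suc n * n) + (n * n + n * 2 + 1)) ≡ suc n * (4 * n + 2)
    identity = solve-∀

  3·detBound<2·extremalLength : ∀ q →
    detBound (3 + q) + detBound (3 + q) + detBound (3 + q) < 2 * extremalLength (2 + q)
  3·detBound<2·extremalLength q = <-by (q * q * 2 + q * 8 + 5) (identity q)
    where
    identity : ∀ q → suc (((3 + q) * (3 + q) + (3 + q) * (3 + q)) + ((3 + q) * (3 + q) + (3 + q) * (3 + q))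
                          + ((3 + q) * (3 + q) + (3 + q) * (3 + q)) + (q * q * 2 + q * 8 + 5))
                     ≡ 2 * ((3 + q) * (4 * (2 + q) + 2))
    identity = solve-∀

  module _ {n A B C x y z : ℕ} (x≤n : x ≤ n) (y≤n : y ≤ n) (z≤n : z ≤ n)
           (balance : A * suc x + B * suc y ≡ C * suc z) where

    private
      bound-if-C≤n : C ≤ n → A + B + C ≤ oneDimBound n
      bound-if-C≤n C≤n = ≤-trans (+-mono-≤ A+B≤ C≤n) (+-mono-≤ (m≤m+n _ _) (m≤m+n n n))
        where
        A+B≤ : A + B ≤ n * suc n
        A+B≤ = ≤-trans (+-mono-≤ (m≤m*n A (suc x)) (m≤m*n B (suc y)))
                       (≤-trans (≤-reflexive balance) (*-mono-≤ C≤n (s≤s z≤n)))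

    -- If z < A then x < C is excluded, so C ≤ n; symmetrically for B; otherwise A, B ≤ z ≤ n.
    two-against-one≤ : ¬ (suc z ≤ A × suc x ≤ C) → ¬ (suc z ≤ B × suc y ≤ C) → A + B + C ≤ oneDimBound n
    two-against-one≤ no-A no-B with suc z ≤? A | suc z ≤? B
    ... | yes z<A | _       = bound-if-C≤n (≤-trans (≮⇒≥ λ x<C → no-A (z<A , x<C)) x≤n)
    ... | no  _   | yes z<B = bound-if-C≤n (≤-trans (≮⇒≥ λ y<C → no-B (z<B , y<C)) y≤n)
    ... | no  z≮A | no  z≮B =
      ≤-trans (≤-reflexive (+-comm (A + B) C)) (+-mono-≤ C≤ (+-mono-≤ (A,B≤n z≮A) (A,B≤n z≮B)))
      where
      A,B≤n : ∀ {D} → ¬ suc z ≤ D → D ≤ n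
      A,B≤n z≮D = ≤-trans (≮⇒≥ z≮D) z≤n
      C≤ : C ≤ n * suc n + n * suc n
      C≤ = ≤-trans (m≤m*n C (suc z)) (≤-trans (≤-reflexive (≡.sym balance))
             (+-mono-≤ (*-mono-≤ (A,B≤n z≮A) (s≤s x≤n)) (*-mono-≤ (A,B≤n z≮B) (s≤s y≤n))))

open Bounds

module Determinants where
  open import Data.Integer using (ℤ; +_; +[1+_]; -[1+_]; -_; _+_; _-_; _*_; ∣_∣)
  import Data.Integer as ℤ
  open import Data.Integer.Properties
  open import Data.Integer.Tactic.RingSolver using (solve-∀)
  import Data.Nat.Properties as ℕₚ

  ∣∣-cong-neg : ∀ {x y} → x ≡ - y → ∣ x ∣ ≡ ∣ y ∣
  ∣∣-cong-neg {y = y} e = trans (cong ∣_∣ e) (∣-i∣≡∣i∣ y)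

  ∣det2∣-swap : ∀ u v → ∣ det2 v u ∣ ≡ ∣ det2 u v ∣
  ∣det2∣-swap (a , b) (c , d) = ∣∣-cong-neg (identity a b c d)
    where
    identity : ∀ a b c d → c * b - a * d ≡ - (a * d - c * b)
    identity = solve-∀

  ∣det2∣-swapIf : ∀ s u v → ∣ det2 (swapIf s u) (swapIf s v) ∣ ≡ ∣ det2 u v ∣
  ∣det2∣-swapIf false u v = refl
  ∣det2∣-swapIf true (a , b) (c , d) = ∣∣-cong-neg (identity a b c d)
    where
    identity : ∀ a b c d → b * c - d * a ≡ - (a * d - c * b)
    identity = solve-∀

  ∣det2∣-negIf : ∀ nx ny a b c d →
    ∣ det2 (negIf nx a , negIf ny b) (negIf nx c , negIf ny d) ∣ ≡ ∣ det2 (a , b) (c , d) ∣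
  ∣det2∣-negIf false false a b c d = refl
  ∣det2∣-negIf true false a b c d = ∣∣-cong-neg (identity a b c d)
    where
    identity : ∀ a b c d → (- a) * d - (- c) * b ≡ - (a * d - c * b)
    identity = solve-∀
  ∣det2∣-negIf false true a b c d = ∣∣-cong-neg (identity a b c d)
    where
    identity : ∀ a b c d → a * (- d) - c * (- b) ≡ - (a * d - c * b)
    identity = solve-∀
  ∣det2∣-negIf true true a b c d = cong ∣_∣ (identity a b c d)
    where
    identity : ∀ a b c d → (- a) * (- d) - (- c) * (- b) ≡ a * d - c * b
    identity = solve-∀

  ∣det2∣-sym : ∀ s nx ny u v → ∣ det2 (sym s nx ny u) (sym s nx ny v) ∣ ≡ ∣ det2 u v ∣
  ∣det2∣-sym s nx ny u v = trans (∣det2∣-negIf nx ny _ _ _ _) (∣det2∣-swapIf s u v)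

  ∣detDel∣-sym : ∀ s nx ny C i → ∣ detDel (sym s nx ny ∘ C) i ∣ ≡ ∣ detDel C i ∣
  ∣detDel∣-sym s nx ny C =
    fin3 (∣det2∣-sym s nx ny (C 1F) (C 2F)) (∣det2∣-sym s nx ny (C 0F) (C 2F)) (∣det2∣-sym s nx ny (C 0F) (C 1F))

  ∣detDel∣-apply : ∀ k C i → ∣ detDel (C ∘ apply k) i ∣ ≡ ∣ detDel C (apply k i) ∣
  ∣detDel∣-apply Perm3.p012 C = fin3 refl refl refl
  ∣detDel∣-apply Perm3.p021 C = fin3 (∣det2∣-swap (C 1F) (C 2F)) refl refl
  ∣detDel∣-apply Perm3.p102 C = fin3 refl refl (∣det2∣-swap (C 0F) (C 1F))
  ∣detDel∣-apply Perm3.p120 C = fin3 (∣det2∣-swap (C 0F) (C 2F)) (∣det2∣-swap (C 0F) (C 1F)) refl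
  ∣detDel∣-apply Perm3.p201 C = fin3 refl (∣det2∣-swap (C 1F) (C 2F)) (∣det2∣-swap (C 0F) (C 2F))
  ∣detDel∣-apply Perm3.p210 C =
    fin3 (∣det2∣-swap (C 0F) (C 1F)) (∣det2∣-swap (C 0F) (C 2F)) (∣det2∣-swap (C 1F) (C 2F))

  det2≡0-if-first≡0 : ∀ u v → proj₁ u ≡ + 0 → proj₁ v ≡ + 0 → det2 u v ≡ + 0
  det2≡0-if-first≡0 u v eu ev = cong₂ (λ s t → s * proj₂ v - t * proj₂ u) eu ev

  det2≡0-if-second≡0 : ∀ u v → proj₂ u ≡ + 0 → proj₂ v ≡ + 0 → det2 u v ≡ + 0
  det2≡0-if-second≡0 u v eu ev =
    trans (cong₂ (λ s t → proj₁ u * t - proj₁ v * s) eu ev) (identity (proj₁ u) (proj₁ v))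
    where
    identity : ∀ a c → a * + 0 - c * + 0 ≡ + 0
    identity = solve-∀

  InRange⇒∣∣≤ : ∀ {m x} → InRange m x → ∣ x ∣ ≤ m
  InRange⇒∣∣≤ {m} {+ n} (_ , x≤m) = drop‿+≤+ x≤m
  InRange⇒∣∣≤ {ℕ.suc m} { -[1+ n ]} (-m≤x , _) = ℕ.s≤s (drop‿-≤- -m≤x)

  InRange-negIf : ∀ {m} b {x} → InRange m x → InRange m (negIf b x)
  InRange-negIf {m} true {x} (-m≤x , x≤m) =
    neg-mono-≤ x≤m , subst (λ t → - x ℤ.≤ t) (neg-involutive (+ m)) (neg-mono-≤ -m≤x)
  InRange-negIf false r = r

  InBox-sym : ∀ {m} s nx ny {u} → InBox m u → InBox m (sym s nx ny u)
  InBox-sym true  nx ny (r₁ , r₂) = InRange-negIf nx r₂ , InRange-negIf ny r₁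
  InBox-sym false nx ny (r₁ , r₂) = InRange-negIf nx r₁ , InRange-negIf ny r₂

  ∣*∣≤ : ∀ x y {k l} → ∣ x ∣ ≤ k → ∣ y ∣ ≤ l → ∣ x * y ∣ ≤ k ℕ.* l
  ∣*∣≤ x y hx hy = subst (ℕ._≤ _) (≡.sym (∣i*j∣≡∣i∣*∣j∣ x y)) (ℕₚ.*-mono-≤ hx hy)

  ∣det2∣≤ : ∀ a b c d {k₁ k₂ k₃ k₄} → ∣ a ∣ ≤ k₁ → ∣ d ∣ ≤ k₂ → ∣ c ∣ ≤ k₃ → ∣ b ∣ ≤ k₄ →
            ∣ det2 (a , b) (c , d) ∣ ≤ k₁ ℕ.* k₂ ℕ.+ k₃ ℕ.* k₄
  ∣det2∣≤ a b c d ha hd hc hb =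
    ℕₚ.≤-trans (∣i-j∣≤∣i∣+∣j∣ (a * d) (c * b)) (ℕₚ.+-mono-≤ (∣*∣≤ a d ha hd) (∣*∣≤ c b hc hb))

  ∣det2∣≤detBound : ∀ {m} u v → InBox m u → InBox m v → ∣ det2 u v ∣ ≤ detBound m
  ∣det2∣≤detBound (a , b) (c , d) (u₁ , u₂) (v₁ , v₂) =
    ∣det2∣≤ a b c d (InRange⇒∣∣≤ u₁) (InRange⇒∣∣≤ v₂) (InRange⇒∣∣≤ v₁) (InRange⇒∣∣≤ u₂)

  data SameSign : ℤ → ℤ → Set where
    both-pos : ∀ a b → SameSign +[1+ a ] +[1+ b ]
    both-neg : ∀ a b → SameSign -[1+ a ] -[1+ b ]

  SameSign-* : ∀ {a b c d} → SameSign a b → SameSign c d → SameSign (a * d) (b * c)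
  SameSign-* (both-pos _ _) (both-pos _ _) = both-pos _ _
  SameSign-* (both-pos _ _) (both-neg _ _) = both-neg _ _
  SameSign-* (both-neg _ _) (both-pos _ _) = both-neg _ _
  SameSign-* (both-neg _ _) (both-neg _ _) = both-pos _ _

  SameSign⇒∣-∣≤pred : ∀ {x y} M → SameSign x y → ∣ x ∣ ≤ M → ∣ y ∣ ≤ M → ∣ x - y ∣ ≤ M ℕ.∸ 1
  SameSign⇒∣-∣≤pred (ℕ.suc M) (both-pos a b) (ℕ.s≤s a≤M) (ℕ.s≤s b≤M)
    rewrite [1+m]⊖[1+n]≡m⊖n a b = ℕₚ.≤-trans (∣m⊝n∣≤m⊔n a b) (ℕₚ.⊔-lub a≤M b≤M)
  SameSign⇒∣-∣≤pred (ℕ.suc M) (both-neg a b) (ℕ.s≤s a≤M) (ℕ.s≤s b≤M)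
    rewrite [1+m]⊖[1+n]≡m⊖n b a = ℕₚ.≤-trans (∣m⊝n∣≤m⊔n b a) (ℕₚ.⊔-lub b≤M a≤M)

  _-ᵖ_ : Pt → Pt → Pt
  (a , b) -ᵖ (c , d) = (a - c , b - d)

  SameQuadrant : Pt → Pt → Set
  SameQuadrant (a , b) (c , d) = SameSign a c × SameSign b d

  -- Two points of one open quadrant of the box differ by less than m in each coordinate.
  sameQuadrant-bound : ∀ n {u v w} → InBox (ℕ.suc n) u → InBox (ℕ.suc n) v → InBox (ℕ.suc n) w →
    SameQuadrant u v → ∣ det2 u v ∣ ℕ.+ ∣ det2 (u -ᵖ v) w ∣ ≤ sameQuadrantBound n
  sameQuadrant-bound n {u₁ , u₂} {v₁ , v₂} {w₁ , w₂} (hu₁ , hu₂) (hv₁ , hv₂) (hw₁ , hw₂) (s₁ , s₂) =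
    ℕₚ.+-mono-≤
      (SameSign⇒∣-∣≤pred (ℕ.suc n ℕ.* ℕ.suc n) (SameSign-* s₁ s₂)
        (∣*∣≤ u₁ v₂ (InRange⇒∣∣≤ hu₁) (InRange⇒∣∣≤ hv₂)) (∣*∣≤ v₁ u₂ (InRange⇒∣∣≤ hv₁) (InRange⇒∣∣≤ hu₂)))
      (∣det2∣≤ (u₁ - v₁) (u₂ - v₂) w₁ w₂
        (SameSign⇒∣-∣≤pred (ℕ.suc n) s₁ (InRange⇒∣∣≤ hu₁) (InRange⇒∣∣≤ hv₁)) (InRange⇒∣∣≤ hw₂)
        (InRange⇒∣∣≤ hw₁) (SameSign⇒∣-∣≤pred (ℕ.suc n) s₂ (InRange⇒∣∣≤ hu₂) (InRange⇒∣∣≤ hv₂)))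

  -- The determinant with rows (1, 1, 1), (x₀, x₁, x₂), (y₀, y₁, y₂): twice the signed area of
  -- the triangle A₀A₁A₂.
  doubleArea : Mat → ℤ
  doubleArea A = detDel A 0F - detDel A 1F + detDel A 2F

  private
    ≤-via-difference : ∀ {B} Z X Y → ∣ Z ∣ ≡ ∣ X - Y ∣ → ∣ X ∣ ℕ.+ ∣ Y ∣ ≤ B → ∣ Z ∣ ≤ B
    ≤-via-difference Z X Y e bound = subst (ℕ._≤ _) (≡.sym e) (ℕₚ.≤-trans (∣i-j∣≤∣i∣+∣j∣ X Y) bound)

  ∣doubleArea∣≤ : ∀ n A → (∀ i → InBox (ℕ.suc n) (A i)) →
    SameQuadrant (A 0F) (A 1F) ⊎ SameQuadrant (A 0F) (A 2F) ⊎ SameQuadrant (A 1F) (A 2F) →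
    ∣ doubleArea A ∣ ≤ sameQuadrantBound n
  ∣doubleArea∣≤ n A box = by-pair
    where
    x₀ y₀ x₁ y₁ x₂ y₂ : ℤ
    x₀ = proj₁ (A 0F)
    y₀ = proj₂ (A 0F)
    x₁ = proj₁ (A 1F)
    y₁ = proj₂ (A 1F)
    x₂ = proj₁ (A 2F)
    y₂ = proj₂ (A 2F)

    by-pair : SameQuadrant (A 0F) (A 1F) ⊎ SameQuadrant (A 0F) (A 2F) ⊎ SameQuadrant (A 1F) (A 2F) →
              ∣ doubleArea A ∣ ≤ sameQuadrantBound n
    by-pair (inj₁ q₀₁) =
      ≤-via-difference (doubleArea A) (det2 (A 0F) (A 1F)) (det2 (A 0F -ᵖ A 1F) (A 2F))
        (cong ∣_∣ (identity₀₁ x₀ y₀ x₁ y₁ x₂ y₂))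
        (sameQuadrant-bound n (box 0F) (box 1F) (box 2F) q₀₁)
      where
      identity₀₁ : ∀ x₀ y₀ x₁ y₁ x₂ y₂ → (x₁ * y₂ - x₂ * y₁) - (x₀ * y₂ - x₂ * y₀) + (x₀ * y₁ - x₁ * y₀) ≡
        (x₀ * y₁ - x₁ * y₀) - ((x₀ - x₁) * y₂ - x₂ * (y₀ - y₁))
      identity₀₁ = solve-∀
    by-pair (inj₂ (inj₁ q₀₂)) =
      ≤-via-difference (doubleArea A) (det2 (A 0F) (A 2F)) (det2 (A 0F -ᵖ A 2F) (A 1F))
        (∣∣-cong-neg (identity₀₂ x₀ y₀ x₁ y₁ x₂ y₂))
        (sameQuadrant-bound n (box 0F) (box 2F) (box 1F) q₀₂)
      where
      identity₀₂ : ∀ x₀ y₀ x₁ y₁ x₂ y₂ → (x₁ * y₂ - x₂ * y₁) - (x₀ * y₂ - x₂ * y₀) + (x₀ * y₁ - x₁ * y₀) ≡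
        - ((x₀ * y₂ - x₂ * y₀) - ((x₀ - x₂) * y₁ - x₁ * (y₀ - y₂)))
      identity₀₂ = solve-∀
    by-pair (inj₂ (inj₂ q₁₂)) =
      ≤-via-difference (doubleArea A) (det2 (A 1F) (A 2F)) (det2 (A 1F -ᵖ A 2F) (A 0F))
        (cong ∣_∣ (identity₁₂ x₀ y₀ x₁ y₁ x₂ y₂))
        (sameQuadrant-bound n (box 1F) (box 2F) (box 0F) q₁₂)
      where
      identity₁₂ : ∀ x₀ y₀ x₁ y₁ x₂ y₂ → (x₁ * y₂ - x₂ * y₁) - (x₀ * y₂ - x₂ * y₀) + (x₀ * y₁ - x₁ * y₀) ≡
        (x₁ * y₂ - x₂ * y₁) - ((x₁ - x₂) * y₀ - x₀ * (y₁ - y₂))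
      identity₁₂ = solve-∀

module IntegerSigns where
  open import Data.Integer using (ℤ; +_; +[1+_]; -[1+_]; +≤+; -≤+)
  import Data.Integer as ℤ
  open import Data.Nat using (z≤n)
  open Signs
  open Determinants using (SameSign; both-pos; both-neg; SameQuadrant)

  signᶻ : ℤ → Sign
  signᶻ (+ 0)     = zer
  signᶻ +[1+ _ ] = pos
  signᶻ -[1+ _ ] = neg

  signᵖ : Pt → SignPair
  signᵖ (a , b) = (signᶻ a , signᶻ b)

  configOf : Mat → Config
  configOf A = (signᵖ (A 0F) , signᵖ (A 1F) , signᵖ (A 2F))

  columns-configOf : ∀ A i → columns (configOf A) i ≡ signᵖ (A i)
  columns-configOf A = fin3 refl refl refl

  signᶻ-negIf : ∀ b x → signᶻ (negIf b x) ≡ negIfˢ b (signᶻ x)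
  signᶻ-negIf false x          = refl
  signᶻ-negIf true  (+ 0)      = refl
  signᶻ-negIf true  +[1+ _ ]  = refl
  signᶻ-negIf true  -[1+ _ ]  = refl

  signᵖ-sym : ∀ s nx ny u → signᵖ (sym s nx ny u) ≡ symˢ s nx ny (signᵖ u)
  signᵖ-sym true  nx ny (a , b) = cong₂ _,_ (signᶻ-negIf nx b) (signᶻ-negIf ny a)
  signᵖ-sym false nx ny (a , b) = cong₂ _,_ (signᶻ-negIf nx a) (signᶻ-negIf ny b)

  nonNeg-sound : ∀ x → T (nonNeg (signᶻ x)) → + 0 ℤ.≤ x
  nonNeg-sound (+ _) _ = +≤+ z≤n

  nonPos-sound : ∀ x → T (nonPos (signᶻ x)) → x ℤ.≤ + 0
  nonPos-sound (+ 0)     _ = +≤+ z≤n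
  nonPos-sound -[1+ _ ] _ = -≤+

  sameStrictSign-sound : ∀ x y → T (sameStrictSign (signᶻ x) (signᶻ y)) → SameSign x y
  sameStrictSign-sound +[1+ a ] +[1+ b ] _ = both-pos a b
  sameStrictSign-sound -[1+ a ] -[1+ b ] _ = both-neg a b
  sameStrictSign-sound (+ 0)     (+ 0)     ()
  sameStrictSign-sound (+ 0)     +[1+ _ ] ()
  sameStrictSign-sound (+ 0)     -[1+ _ ] ()
  sameStrictSign-sound +[1+ _ ] (+ 0)     ()
  sameStrictSign-sound +[1+ _ ] -[1+ _ ] ()
  sameStrictSign-sound -[1+ _ ] (+ 0)     ()
  sameStrictSign-sound -[1+ _ ] +[1+ _ ] ()

  sameOpenQuadrant-sound : ∀ u v → T (sameOpenQuadrant (signᵖ u) (signᵖ v)) → SameQuadrant u v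
  sameOpenQuadrant-sound (a , b) (c , d) h =
    let h₁ , h₂ = Equivalence.to T-∧ h in sameStrictSign-sound a c h₁ , sameStrictSign-sound b d h₂

  allSigns : (Sign → Bool) → (Fin 3 → ℤ) → Bool
  allSigns P z = P (signᶻ (z 0F)) ∧ P (signᶻ (z 1F)) ∧ P (signᶻ (z 2F))

  allSigns-sound : ∀ (P : Sign → Bool) z → T (allSigns P z) → ∀ i → T (P (signᶻ (z i)))
  allSigns-sound P z h =
    let h₀ , h₁₂ = Equivalence.to T-∧ h
        h₁ , h₂  = Equivalence.to T-∧ h₁₂
    in fin3 h₀ h₁ h₂

  patternC′-cong : ∀ {b c : Fin 3 → SignPair} → (∀ i → b i ≡ c i) → patternC′ b ≡ patternC′ c
  patternC′-cong e = cong₃ (λ u v w → patternC′ ⟨ u , v , w ⟩) (e 0F) (e 1F) (e 2F)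

  SignPatternC′ : Mat → Set
  SignPatternC′ A =
    ((+ 0 ℤ.≤ proj₁ (A 0F)) × (proj₁ (A 1F) ℤ.≤ + 0) × (+ 0 ℤ.≤ proj₁ (A 2F))) ×
    ((+ 0 ℤ.≤ proj₂ (A 0F)) × (+ 0 ℤ.≤ proj₂ (A 1F)) × (proj₂ (A 2F) ℤ.≤ + 0))

  patternC′-sound : ∀ A → T (patternC′ (signᵖ ∘ A)) → SignPatternC′ A
  patternC′-sound A h =
    let h₁ , r₁ = Equivalence.to T-∧ h
        h₂ , r₂ = Equivalence.to T-∧ r₁
        h₃ , r₃ = Equivalence.to T-∧ r₂
        h₄ , r₄ = Equivalence.to T-∧ r₃
        h₅ , h₆ = Equivalence.to T-∧ r₄
    in (nonNeg-sound _ h₁ , nonPos-sound _ h₂ , nonNeg-sound _ h₃) ,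
       (nonNeg-sound _ h₄ , nonNeg-sound _ h₅ , nonPos-sound _ h₆)

module OneDimensional where
  open import Data.Integer using (ℤ; +_; +[1+_]; -[1+_]; -_; _+_; _-_; _*_; ∣_∣; +≤+; -≤+)
  import Data.Integer as ℤ
  open import Data.Integer.Properties
    using (+-injective; neg-injective; neg-mono-≤; pos-+; pos-*; *-zeroʳ; 0≤i⇒+∣i∣≡i; i-j≡0⇒i≡j)
  open import Data.Integer.Tactic.RingSolver using (solve-∀)
  open import Data.Nat using (suc; z≤n; s≤s; s≤s⁻¹)
  import Data.Nat.Properties as ℕₚ

  combination : (Fin 3 → ℕ) → (Fin 3 → ℤ) → ℤ
  combination j z = + j 0F * z 0F + (+ j 1F * z 1F + + j 2F * z 2F)

  MinimalZeroSumℤ : (Fin 3 → ℕ) → (Fin 3 → ℤ) → Set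
  MinimalZeroSumℤ a z = combination a z ≡ + 0 ×
    (∀ j → (∀ i → j i ≤ a i) → (∃[ i ] 1 ≤ j i) → (∃[ i ] j i ≢ a i) → combination j z ≢ + 0)

  combination-cong : ∀ j {z z′} → (∀ i → z i ≡ z′ i) → combination j z ≡ combination j z′
  combination-cong j e = cong₃ (λ u v w → combination j ⟨ u , v , w ⟩) (e 0F) (e 1F) (e 2F)

  combination-neg : ∀ j z → combination j (-_ ∘ z) ≡ - combination j z
  combination-neg j z = identity (+ j 0F) (+ j 1F) (+ j 2F) (z 0F) (z 1F) (z 2F)
    where
    identity : ∀ a b c x y z → a * - x + (b * - y + c * - z) ≡ - (a * x + (b * y + c * z))
    identity = solve-∀

  combination-pos : ∀ j k → combination j (+_ ∘ k) ≡ + (j 0F ℕ.* k 0F ℕ.+ (j 1F ℕ.* k 1F ℕ.+ j 2F ℕ.* k 2F))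
  combination-pos j k = ≡.sym (trans (pos-+ (j 0F ℕ.* k 0F) _)
    (cong₂ _+_ (pos-* (j 0F) (k 0F))
      (trans (pos-+ (j 1F ℕ.* k 1F) _) (cong₂ _+_ (pos-* (j 1F) (k 1F)) (pos-* (j 2F) (k 2F))))))

  combination-scale : ∀ {j r} d z → (∀ i → j i ≡ r i ℕ.* d) → combination j z ≡ + d * combination r z
  combination-scale {j} {r} d z e =
    trans (cong₃ (λ u v w → u * z 0F + (v * z 1F + w * z 2F)) (scaled 0F) (scaled 1F) (scaled 2F))
          (identity (+ r 0F) (+ r 1F) (+ r 2F) (+ d) (z 0F) (z 1F) (z 2F))
    where
    scaled : ∀ i → + j i ≡ + r i * + d
    scaled i = trans (cong +_ (e i)) (pos-* (r i) d)
    identity : ∀ a b c d x y z → (a * d) * x + ((b * d) * y + (c * d) * z) ≡ d * (a * x + (b * y + c * z))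
    identity = solve-∀

  combination-zero : ∀ j → combination j (λ _ → + 0) ≡ + 0
  combination-zero j = cong₂ _+_ (*-zeroʳ (+ j 0F)) (cong₂ _+_ (*-zeroʳ (+ j 1F)) (*-zeroʳ (+ j 2F)))

  MinimalZeroSumℤ-neg : ∀ {a} z → MinimalZeroSumℤ a z → MinimalZeroSumℤ a (-_ ∘ z)
  MinimalZeroSumℤ-neg {a} z (zero-sum , minimal) =
    trans (combination-neg a z) (cong -_ zero-sum) ,
    λ j le ne pr e → minimal j le ne pr (neg-injective (trans (≡.sym (combination-neg j z)) e))

  nonneg-zero-combination : ∀ {a z} → (∀ i → 1 ≤ a i) → (∀ i → + 0 ℤ.≤ z i) →
                            combination a z ≡ + 0 → ∀ i → z i ≡ + 0
  nonneg-zero-combination {a} {z} a>0 z≥0 zero-sum i =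
    trans (≡.sym (0≤i⇒+∣i∣≡i (z≥0 i))) (cong +_ (fin3 {P = λ i → k i ≡ 0} ∣z₀∣≡0 ∣z₁∣≡0 ∣z₂∣≡0 i))
    where
    k : Fin 3 → ℕ
    k = ∣_∣ ∘ z
    sum≡0 : a 0F ℕ.* k 0F ℕ.+ (a 1F ℕ.* k 1F ℕ.+ a 2F ℕ.* k 2F) ≡ 0
    sum≡0 = +-injective (trans (≡.sym (combination-pos a k))
                               (trans (combination-cong a (λ i → 0≤i⇒+∣i∣≡i (z≥0 i))) zero-sum))
    factor≡0 : ∀ i → a i ℕ.* k i ≡ 0 → k i ≡ 0
    factor≡0 i e with ℕₚ.m*n≡0⇒m≡0∨n≡0 (a i) e
    ... | inj₁ a≡0 = ⊥-elim (1≤⇒0≢ (a>0 i) (≡.sym a≡0))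
    ... | inj₂ k≡0 = k≡0
    ∣z₀∣≡0 : k 0F ≡ 0
    ∣z₀∣≡0 = factor≡0 0F (ℕₚ.m+n≡0⇒m≡0 (a 0F ℕ.* k 0F) sum≡0)
    ∣z₁∣≡0 : k 1F ≡ 0
    ∣z₁∣≡0 = factor≡0 1F (ℕₚ.m+n≡0⇒m≡0 (a 1F ℕ.* k 1F) (ℕₚ.m+n≡0⇒n≡0 (a 0F ℕ.* k 0F) sum≡0))
    ∣z₂∣≡0 : k 2F ≡ 0
    ∣z₂∣≡0 = factor≡0 2F (ℕₚ.m+n≡0⇒n≡0 (a 1F ℕ.* k 1F) (ℕₚ.m+n≡0⇒n≡0 (a 0F ℕ.* k 0F) sum≡0))

  one-signed-zero-combination : ∀ {a z} → (∀ i → 1 ≤ a i) → combination a z ≡ + 0 →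
    (∀ i → + 0 ℤ.≤ z i) ⊎ (∀ i → z i ℤ.≤ + 0) → ∀ i → z i ≡ + 0
  one-signed-zero-combination a>0 zero-sum (inj₁ z≥0) = nonneg-zero-combination a>0 z≥0 zero-sum
  one-signed-zero-combination {a} {z} a>0 zero-sum (inj₂ z≤0) i =
    neg-injective (nonneg-zero-combination a>0 (λ i → neg-mono-≤ (z≤0 i))
                    (trans (combination-neg a z) (cong -_ zero-sum)) i)

  private
    balance : ∀ A X B Y C Z → + A * + X + + B * + Y - + C * + Z ≡ + 0 → A ℕ.* X ℕ.+ B ℕ.* Y ≡ C ℕ.* Z
    balance A X B Y C Z e = +-injective (trans (pos-+ (A ℕ.* X) (B ℕ.* Y))
      (trans (cong₂ _+_ (pos-* A X) (pos-* B Y)) (trans (i-j≡0⇒i≡j _ _ e) (≡.sym (pos-* C Z)))))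

  -- In each sign case, w+1 copies of a positive value u+1 together with u+1 copies of the
  -- negative value -(w+1) would be a proper zero-sum subsequence.
  bound-++- : ∀ {n a} u v w → (∀ i → 1 ≤ a i) → u ≤ n → v ≤ n → w ≤ n →
    MinimalZeroSumℤ a ⟨ +[1+ u ] , +[1+ v ] , -[1+ w ] ⟩ → sum₃ a ≤ oneDimBound n
  bound-++- {a = a} u v w a>0 u≤n v≤n w≤n (zero-sum , minimal) =
    two-against-one≤ u≤n v≤n w≤n
      (balance (a 0F) (suc u) (a 1F) (suc v) (a 2F) (suc w)
        (trans (regroup (+ a 0F * +[1+ u ]) (+ a 1F * +[1+ v ]) (+ a 2F) +[1+ w ]) zero-sum))
      (λ (w<a₀ , u<a₂) → minimal ⟨ suc w , 0 , suc u ⟩ (fin3 w<a₀ z≤n u<a₂) (0F , s≤s z≤n)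
                           (1F , 1≤⇒0≢ (a>0 1F)) (cancel +[1+ w ] +[1+ u ] +[1+ v ]))
      (λ (w<a₁ , v<a₂) → minimal ⟨ 0 , suc w , suc v ⟩ (fin3 z≤n w<a₁ v<a₂) (1F , s≤s z≤n)
                           (0F , 1≤⇒0≢ (a>0 0F)) (cancel′ +[1+ w ] +[1+ v ] +[1+ u ]))
    where
    regroup : ∀ P Q R S → P + Q - R * S ≡ P + (Q + R * - S)
    regroup = solve-∀
    cancel : ∀ P Q R → P * Q + (+ 0 * R + Q * - P) ≡ + 0
    cancel = solve-∀
    cancel′ : ∀ P Q R → + 0 * R + (P * Q + Q * - P) ≡ + 0
    cancel′ = solve-∀

  bound-+-+ : ∀ {n a} u w v → (∀ i → 1 ≤ a i) → u ≤ n → v ≤ n → w ≤ n →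
    MinimalZeroSumℤ a ⟨ +[1+ u ] , -[1+ w ] , +[1+ v ] ⟩ → sum₃ a ≤ oneDimBound n
  bound-+-+ {n} {a} u w v a>0 u≤n v≤n w≤n (zero-sum , minimal) =
    subst (_≤ oneDimBound n) (sum₃-apply Perm3.p021 a) (two-against-one≤ u≤n v≤n w≤n
      (balance (a 0F) (suc u) (a 2F) (suc v) (a 1F) (suc w)
        (trans (regroup (+ a 0F * +[1+ u ]) (+ a 1F) (+ a 2F * +[1+ v ]) +[1+ w ]) zero-sum))
      (λ (w<a₀ , u<a₁) → minimal ⟨ suc w , suc u , 0 ⟩ (fin3 w<a₀ u<a₁ z≤n) (0F , s≤s z≤n)
                           (2F , 1≤⇒0≢ (a>0 2F)) (cancel +[1+ w ] +[1+ u ] +[1+ v ]))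
      (λ (w<a₂ , v<a₁) → minimal ⟨ 0 , suc v , suc w ⟩ (fin3 z≤n v<a₁ w<a₂) (2F , s≤s z≤n)
                           (0F , 1≤⇒0≢ (a>0 0F)) (cancel′ +[1+ w ] +[1+ v ] +[1+ u ])))
    where
    regroup : ∀ P R Q S → P + Q - R * S ≡ P + (R * - S + Q)
    regroup = solve-∀
    cancel : ∀ P Q R → P * Q + (Q * - P + + 0 * R) ≡ + 0
    cancel = solve-∀
    cancel′ : ∀ P Q R → + 0 * R + (Q * - P + P * Q) ≡ + 0
    cancel′ = solve-∀

  bound--++ : ∀ {n a} w u v → (∀ i → 1 ≤ a i) → u ≤ n → v ≤ n → w ≤ n →
    MinimalZeroSumℤ a ⟨ -[1+ w ] , +[1+ u ] , +[1+ v ] ⟩ → sum₃ a ≤ oneDimBound n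
  bound--++ {n} {a} w u v a>0 u≤n v≤n w≤n (zero-sum , minimal) =
    subst (_≤ oneDimBound n) (sum₃-apply Perm3.p120 a) (two-against-one≤ u≤n v≤n w≤n
      (balance (a 1F) (suc u) (a 2F) (suc v) (a 0F) (suc w)
        (trans (regroup (+ a 0F) (+ a 1F * +[1+ u ]) (+ a 2F * +[1+ v ]) +[1+ w ]) zero-sum))
      (λ (w<a₁ , u<a₀) → minimal ⟨ suc u , suc w , 0 ⟩ (fin3 u<a₀ w<a₁ z≤n) (1F , s≤s z≤n)
                           (2F , 1≤⇒0≢ (a>0 2F)) (cancel +[1+ w ] +[1+ u ] +[1+ v ]))
      (λ (w<a₂ , v<a₀) → minimal ⟨ suc v , 0 , suc w ⟩ (fin3 v<a₀ z≤n w<a₂) (2F , s≤s z≤n)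
                           (1F , 1≤⇒0≢ (a>0 1F)) (cancel′ +[1+ w ] +[1+ v ] +[1+ u ])))
    where
    regroup : ∀ R P Q S → P + Q - R * S ≡ R * - S + (P + Q)
    regroup = solve-∀
    cancel : ∀ P Q R → Q * - P + (P * Q + + 0 * R) ≡ + 0
    cancel = solve-∀
    cancel′ : ∀ P Q R → Q * - P + (+ 0 * R + P * Q) ≡ + 0
    cancel′ = solve-∀

  oneDim-bound-by-signs : ∀ {n a} z₀ z₁ z₂ → (∀ i → 1 ≤ a i) → (∀ i → ⟨ z₀ , z₁ , z₂ ⟩ i ≢ + 0) →
    (∀ i → ∣ ⟨ z₀ , z₁ , z₂ ⟩ i ∣ ≤ suc n) → MinimalZeroSumℤ a ⟨ z₀ , z₁ , z₂ ⟩ → sum₃ a ≤ oneDimBound n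
  oneDim-bound-by-signs (+ 0) _ _ _ z≢0 _ _ = ⊥-elim (z≢0 0F refl)
  oneDim-bound-by-signs _ (+ 0) _ _ z≢0 _ _ = ⊥-elim (z≢0 1F refl)
  oneDim-bound-by-signs _ _ (+ 0) _ z≢0 _ _ = ⊥-elim (z≢0 2F refl)
  oneDim-bound-by-signs +[1+ u ] +[1+ v ] -[1+ w ] a>0 _ ∣z∣≤ min =
    bound-++- u v w a>0 (s≤s⁻¹ (∣z∣≤ 0F)) (s≤s⁻¹ (∣z∣≤ 1F)) (s≤s⁻¹ (∣z∣≤ 2F)) min
  oneDim-bound-by-signs +[1+ u ] -[1+ w ] +[1+ v ] a>0 _ ∣z∣≤ min =
    bound-+-+ u w v a>0 (s≤s⁻¹ (∣z∣≤ 0F)) (s≤s⁻¹ (∣z∣≤ 2F)) (s≤s⁻¹ (∣z∣≤ 1F)) min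
  oneDim-bound-by-signs -[1+ w ] +[1+ u ] +[1+ v ] a>0 _ ∣z∣≤ min =
    bound--++ w u v a>0 (s≤s⁻¹ (∣z∣≤ 1F)) (s≤s⁻¹ (∣z∣≤ 2F)) (s≤s⁻¹ (∣z∣≤ 0F)) min
  oneDim-bound-by-signs z₀@(-[1+ u ]) z₁@(-[1+ v ]) z₂@(+[1+ w ]) a>0 _ ∣z∣≤ min =
    bound-++- u v w a>0 (s≤s⁻¹ (∣z∣≤ 0F)) (s≤s⁻¹ (∣z∣≤ 1F)) (s≤s⁻¹ (∣z∣≤ 2F))
      (MinimalZeroSumℤ-neg ⟨ z₀ , z₁ , z₂ ⟩ min)
  oneDim-bound-by-signs z₀@(-[1+ u ]) z₁@(+[1+ w ]) z₂@(-[1+ v ]) a>0 _ ∣z∣≤ min =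
    bound-+-+ u w v a>0 (s≤s⁻¹ (∣z∣≤ 0F)) (s≤s⁻¹ (∣z∣≤ 2F)) (s≤s⁻¹ (∣z∣≤ 1F))
      (MinimalZeroSumℤ-neg ⟨ z₀ , z₁ , z₂ ⟩ min)
  oneDim-bound-by-signs z₀@(+[1+ w ]) z₁@(-[1+ u ]) z₂@(-[1+ v ]) a>0 _ ∣z∣≤ min =
    bound--++ w u v a>0 (s≤s⁻¹ (∣z∣≤ 1F)) (s≤s⁻¹ (∣z∣≤ 2F)) (s≤s⁻¹ (∣z∣≤ 0F))
      (MinimalZeroSumℤ-neg ⟨ z₀ , z₁ , z₂ ⟩ min)
  oneDim-bound-by-signs z₀@(+[1+ _ ]) z₁@(+[1+ _ ]) z₂@(+[1+ _ ]) a>0 _ _ (zero-sum , _) =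
    case one-signed-zero-combination {z = ⟨ z₀ , z₁ , z₂ ⟩} a>0 zero-sum
           (inj₁ (fin3 (+≤+ z≤n) (+≤+ z≤n) (+≤+ z≤n))) 0F of λ ()
  oneDim-bound-by-signs z₀@(-[1+ _ ]) z₁@(-[1+ _ ]) z₂@(-[1+ _ ]) a>0 _ _ (zero-sum , _) =
    case one-signed-zero-combination {z = ⟨ z₀ , z₁ , z₂ ⟩} a>0 zero-sum (inj₂ (fin3 -≤+ -≤+ -≤+)) 0F of λ ()

  oneDim-bound : ∀ {n a} z → (∀ i → 1 ≤ a i) → (∀ i → z i ≢ + 0) → (∀ i → ∣ z i ∣ ≤ suc n) →
    MinimalZeroSumℤ a z → sum₃ a ≤ oneDimBound n
  oneDim-bound z a>0 z≢0 ∣z∣≤ =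
    oneDim-bound-by-signs (z 0F) (z 1F) (z 2F) a>0
      (fin3 (z≢0 0F) (z≢0 1F) (z≢0 2F)) (fin3 (∣z∣≤ 0F) (∣z∣≤ 1F) (∣z∣≤ 2F))

module Cramer (p : Fin 3 → Pt) (a : Fin 3 → ℕ) (zero-sum : wsum a p ≡ 0ᵖ) where
  open import Data.Integer using (ℤ; +_; -_; _+_; _-_; _*_; ∣_∣)
  open import Data.Integer.Properties using (i-j≡0⇒i≡j; abs-*; ∣-i∣≡∣i∣; pos-+)
  open import Data.Integer.Tactic.RingSolver using (solve-∀)
  open OneDimensional using (combination)
  open Determinants using (doubleArea)
  open ≡.≡-Reasoning

  private
    x y D : Fin 3 → ℤ
    x = proj₁ ∘ p
    y = proj₂ ∘ p
    D = detDel p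

    vanishes : ∀ {L} c d → L ≡ c * combination a x - d * combination a y → L ≡ + 0
    vanishes c d e = trans e (trans (cong₂ (λ s t → c * s - d * t) (cong proj₁ zero-sum) (cong proj₂ zero-sum))
                                    (identity c d))
      where
      identity : ∀ c d → c * + 0 - d * + 0 ≡ + 0
      identity = solve-∀

  cramer₀₁ : + a 1F * D 0F ≡ + a 0F * - D 1F
  cramer₀₁ = i-j≡0⇒i≡j _ _ (vanishes (y 2F) (x 2F)
    (identity (+ a 0F) (+ a 1F) (+ a 2F) (x 0F) (x 1F) (x 2F) (y 0F) (y 1F) (y 2F)))
    where
    identity : ∀ a₀ a₁ a₂ x₀ x₁ x₂ y₀ y₁ y₂ →
      a₁ * (x₁ * y₂ - x₂ * y₁) - a₀ * - (x₀ * y₂ - x₂ * y₀) ≡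
      y₂ * (a₀ * x₀ + (a₁ * x₁ + a₂ * x₂)) - x₂ * (a₀ * y₀ + (a₁ * y₁ + a₂ * y₂))
    identity = solve-∀

  cramer₀₂ : + a 2F * D 0F ≡ + a 0F * D 2F
  cramer₀₂ = i-j≡0⇒i≡j _ _ (vanishes (- y 1F) (- x 1F)
    (identity (+ a 0F) (+ a 1F) (+ a 2F) (x 0F) (x 1F) (x 2F) (y 0F) (y 1F) (y 2F)))
    where
    identity : ∀ a₀ a₁ a₂ x₀ x₁ x₂ y₀ y₁ y₂ →
      a₂ * (x₁ * y₂ - x₂ * y₁) - a₀ * (x₀ * y₁ - x₁ * y₀) ≡
      (- y₁) * (a₀ * x₀ + (a₁ * x₁ + a₂ * x₂)) - (- x₁) * (a₀ * y₀ + (a₁ * y₁ + a₂ * y₂))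
    identity = solve-∀

  cramer₁₂ : + a 2F * D 1F ≡ + a 1F * - D 2F
  cramer₁₂ = i-j≡0⇒i≡j _ _ (vanishes (- y 0F) (- x 0F)
    (identity (+ a 0F) (+ a 1F) (+ a 2F) (x 0F) (x 1F) (x 2F) (y 0F) (y 1F) (y 2F)))
    where
    identity : ∀ a₀ a₁ a₂ x₀ x₁ x₂ y₀ y₁ y₂ →
      a₂ * (x₀ * y₂ - x₂ * y₀) - a₁ * - (x₀ * y₁ - x₁ * y₀) ≡
      (- y₀) * (a₀ * x₀ + (a₁ * x₁ + a₂ * x₂)) - (- x₀) * (a₀ * y₀ + (a₁ * y₁ + a₂ * y₂))
    identity = solve-∀

  ∣cramer₀₁∣ : a 1F ℕ.* ∣ D 0F ∣ ≡ a 0F ℕ.* ∣ D 1F ∣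
  ∣cramer₀₁∣ = begin
    a 1F ℕ.* ∣ D 0F ∣     ≡⟨ abs-* (+ a 1F) (D 0F) ⟨
    ∣ + a 1F * D 0F ∣     ≡⟨ cong ∣_∣ cramer₀₁ ⟩
    ∣ + a 0F * - D 1F ∣   ≡⟨ abs-* (+ a 0F) (- D 1F) ⟩
    a 0F ℕ.* ∣ - D 1F ∣   ≡⟨ cong (a 0F ℕ.*_) (∣-i∣≡∣i∣ (D 1F)) ⟩
    a 0F ℕ.* ∣ D 1F ∣     ∎

  ∣cramer₀₂∣ : a 2F ℕ.* ∣ D 0F ∣ ≡ a 0F ℕ.* ∣ D 2F ∣
  ∣cramer₀₂∣ = trans (≡.sym (abs-* (+ a 2F) (D 0F))) (trans (cong ∣_∣ cramer₀₂) (abs-* (+ a 0F) (D 2F)))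

  sum₃·D₀ : + sum₃ a * D 0F ≡ + a 0F * doubleArea p
  sum₃·D₀ = begin
    + sum₃ a * D 0F                                      ≡⟨ cong (_* D 0F) pos-sum₃ ⟩
    (+ a 0F + + a 1F + + a 2F) * D 0F                    ≡⟨ distribute (+ a 0F) (+ a 1F) (+ a 2F) (D 0F) ⟩
    + a 0F * D 0F + + a 1F * D 0F + + a 2F * D 0F        ≡⟨ cong₂ (λ s t → + a 0F * D 0F + s + t) cramer₀₁ cramer₀₂ ⟩
    + a 0F * D 0F + + a 0F * - D 1F + + a 0F * D 2F      ≡⟨ factor (+ a 0F) (D 0F) (D 1F) (D 2F) ⟩
    + a 0F * doubleArea p                                ∎
    where
    pos-sum₃ : + sum₃ a ≡ + a 0F + + a 1F + + a 2F
    pos-sum₃ = trans (pos-+ (a 0F ℕ.+ a 1F) (a 2F)) (cong (_+ + a 2F) (pos-+ (a 0F) (a 1F)))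
    distribute : ∀ a₀ a₁ a₂ d → (a₀ + a₁ + a₂) * d ≡ a₀ * d + a₁ * d + a₂ * d
    distribute = solve-∀
    factor : ∀ a₀ d₀ d₁ d₂ → a₀ * d₀ + a₀ * - d₁ + a₀ * d₂ ≡ a₀ * (d₀ - d₁ + d₂)
    factor = solve-∀

module MinimalSequence (S : Seq3) (min : MinZeroSum S) where
  open import Data.Integer using (ℤ; +_; -_; _+_; _-_; _*_; ∣_∣; _≟_)
  open import Data.Integer.Properties
    using (i-j≡0⇒i≡j; *-cancelˡ-≡; *-zeroʳ; *-comm; i*j≡0⇒i≡0∨j≡0)
  open import Data.Integer.Tactic.RingSolver using (solve-∀)
  open import Data.Nat using (suc; z≤n; s≤s)
  import Data.Nat.Properties as ℕₚ
  import Algebra.Properties.CommutativeSemigroup ℕₚ.*-commutativeSemigroup as *-CS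
  open import Data.Nat.Divisibility using (divides; n∣m*n)
  open import Data.Nat.GCD using (gcd-greatest; c*gcd[m,n]≡gcd[cm,cn])
  open OneDimensional
  open Determinants using (InRange⇒∣∣≤)

  p : Fin 3 → Pt
  p = pt S

  a : Fin 3 → ℕ
  a = mult S

  x y D : Fin 3 → ℤ
  x = proj₁ ∘ p
  y = proj₂ ∘ p
  D = detDel p

  open Cramer p a (proj₁ min) public

  x-sum : combination a x ≡ + 0
  x-sum = cong proj₁ (proj₁ min)

  y-sum : combination a y ≡ + 0
  y-sum = cong proj₂ (proj₁ min)

  no-proper-zero-subsum : ∀ j → (∀ i → j i ≤ a i) → (∃[ i ] 1 ≤ j i) → (∃[ i ] j i ≢ a i) →
                          combination j x ≡ + 0 → combination j y ≢ + 0
  no-proper-zero-subsum j le ne pr ex ey = proj₂ min j le ne pr (cong₂ _,_ ex ey)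

  no-zero-column : ∀ i → x i ≡ + 0 → y i ≢ + 0
  no-zero-column 0F ex ey = no-proper-zero-subsum ⟨ 1 , 0 , 0 ⟩ (fin3 (multPos S 0F) z≤n z≤n)
    (0F , s≤s z≤n) (1F , 1≤⇒0≢ (multPos S 1F)) (cong (λ t → + 1 * t + (+ 0 * x 1F + + 0 * x 2F)) ex)
    (cong (λ t → + 1 * t + (+ 0 * y 1F + + 0 * y 2F)) ey)
  no-zero-column 1F ex ey = no-proper-zero-subsum ⟨ 0 , 1 , 0 ⟩ (fin3 z≤n (multPos S 1F) z≤n)
    (1F , s≤s z≤n) (0F , 1≤⇒0≢ (multPos S 0F)) (cong (λ t → + 0 * x 0F + (+ 1 * t + + 0 * x 2F)) ex)
    (cong (λ t → + 0 * y 0F + (+ 1 * t + + 0 * y 2F)) ey)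
  no-zero-column 2F ex ey = no-proper-zero-subsum ⟨ 0 , 0 , 1 ⟩ (fin3 z≤n z≤n (multPos S 2F))
    (2F , s≤s z≤n) (0F , 1≤⇒0≢ (multPos S 0F)) (cong (λ t → + 0 * x 0F + (+ 0 * x 1F + + 1 * t)) ex)
    (cong (λ t → + 0 * y 0F + (+ 0 * y 1F + + 1 * t)) ey)

  -- Dividing all multiplicities by a common factor d ≥ 2 gives a proper zero-sum subsequence.
  mult-coprime : ∀ d → d ∣ a 0F → d ∣ a 1F → d ∣ a 2F → d ≡ 1
  mult-coprime 0 (divides r e) _ _ = ⊥-elim (1≤⇒0≢ (multPos S 0F) (≡.sym (trans e (ℕₚ.*-zeroʳ r))))
  mult-coprime 1 _ _ _ = refl
  mult-coprime d@(suc (suc _)) (divides r₀ e₀) (divides r₁ e₁) (divides r₂ e₂) =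
    ⊥-elim (no-proper-zero-subsum r r≤a (0F , r₀≥1) (0F , r₀≢a₀) (quotient-sum x x-sum) (quotient-sum y y-sum))
    where
    r : Fin 3 → ℕ
    r = ⟨ r₀ , r₁ , r₂ ⟩
    a≡r*d : ∀ i → a i ≡ r i ℕ.* d
    a≡r*d = fin3 e₀ e₁ e₂
    quotient-sum : ∀ z → combination a z ≡ + 0 → combination r z ≡ + 0
    quotient-sum z e = *-cancelˡ-≡ (+ d) (combination r z) (+ 0)
      (trans (≡.sym (combination-scale {r = r} d z a≡r*d)) (trans e (≡.sym (*-zeroʳ (+ d)))))
    r≤a : ∀ i → r i ≤ a i
    r≤a i = subst (r i ≤_) (≡.sym (a≡r*d i)) (ℕₚ.m≤m*n (r i) d)
    r₀≥1 : 1 ≤ r₀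
    r₀≥1 = positive e₀
      where
      positive : ∀ {r} → a 0F ≡ r ℕ.* d → 1 ≤ r
      positive {0}     e = ⊥-elim (1≤⇒0≢ (multPos S 0F) (≡.sym e))
      positive {suc _} _ = s≤s z≤n
    r₀≢a₀ : r₀ ≢ a 0F
    r₀≢a₀ e = ℕₚ.<-irrefl e (subst (r₀ ℕ.<_) (≡.sym e₀) (ℕₚ.m<m*n r₀ d {{ℕ.>-nonZero r₀≥1}} (s≤s (s≤s z≤n))))

  ∣det∣≡t*mult : ∃[ t ] (∀ i → ∣ D i ∣ ≡ t ℕ.* a i)
  ∣det∣≡t*mult = t , fin3 ∣D₀∣≡ (cancel ∣cramer₀₁∣) (cancel ∣cramer₀₂∣)
    where
    a₀∣∣D₀∣ : a 0F ∣ ∣ D 0F ∣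
    a₀∣∣D₀∣ = subst (a 0F ∣_) gcd≡∣D₀∣ (gcd-greatest (gcd-greatest (n∣m*n c) (divides ∣ D 1F ∣ (swap ∣cramer₀₁∣)))
                                                                    (divides ∣ D 2F ∣ (swap ∣cramer₀₂∣)))
      where
      c : ℕ
      c = ∣ D 0F ∣
      swap : ∀ {i} → a i ℕ.* c ≡ a 0F ℕ.* ∣ D i ∣ → c ℕ.* a i ≡ ∣ D i ∣ ℕ.* a 0F
      swap {i} e = trans (ℕₚ.*-comm c (a i)) (trans e (ℕₚ.*-comm (a 0F) ∣ D i ∣))
      gcd≡∣D₀∣ : gcd (gcd (c ℕ.* a 0F) (c ℕ.* a 1F)) (c ℕ.* a 2F) ≡ c
      gcd≡∣D₀∣ = begin
        gcd (gcd (c ℕ.* a 0F) (c ℕ.* a 1F)) (c ℕ.* a 2F) ≡⟨ cong (λ g → gcd g (c ℕ.* a 2F))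
                                                              (c*gcd[m,n]≡gcd[cm,cn] c (a 0F) (a 1F)) ⟨
        gcd (c ℕ.* gcd (a 0F) (a 1F)) (c ℕ.* a 2F)       ≡⟨ c*gcd[m,n]≡gcd[cm,cn] c (gcd (a 0F) (a 1F)) (a 2F) ⟨
        c ℕ.* gcd₃ a                                     ≡⟨ cong (c ℕ.*_)
                                                              (mult-coprime _ (gcd₃∣ a 0F) (gcd₃∣ a 1F) (gcd₃∣ a 2F)) ⟩
        c ℕ.* 1                                          ≡⟨ ℕₚ.*-identityʳ c ⟩
        c                                                ∎
        where open ≡.≡-Reasoning
    t : ℕ
    t = _∣_.quotient a₀∣∣D₀∣
    ∣D₀∣≡ : ∣ D 0F ∣ ≡ t ℕ.* a 0F
    ∣D₀∣≡ = _∣_.equality a₀∣∣D₀∣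
    cancel : ∀ {i} → a i ℕ.* ∣ D 0F ∣ ≡ a 0F ℕ.* ∣ D i ∣ → ∣ D i ∣ ≡ t ℕ.* a i
    cancel {i} e = ℕₚ.*-cancelˡ-≡ _ _ (a 0F) {{ℕ.>-nonZero (multPos S 0F)}}
      (trans (≡.sym e) (trans (cong (a i ℕ.*_) ∣D₀∣≡) (*-CS.x∙yz≈z∙yx (a i) t (a 0F))))

  private
    factor≡0 : ∀ u {v} → u * v ≡ + 0 → v ≢ + 0 → u ≡ + 0
    factor≡0 u e v≢0 with i*j≡0⇒i≡0∨j≡0 u e
    ... | inj₁ u≡0 = u≡0
    ... | inj₂ v≡0 = ⊥-elim (v≢0 v≡0)

    cross : D 2F ≡ + 0 → x 0F * y 1F ≡ x 1F * y 0F
    cross D₂≡0 = i-j≡0⇒i≡j _ _ D₂≡0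

    cross′ : D 1F ≡ + 0 → x 0F * y 2F ≡ x 2F * y 0F
    cross′ D₁≡0 = i-j≡0⇒i≡j _ _ D₁≡0

  collinear-vertical : (∀ i → D i ≡ + 0) → x 0F ≡ + 0 → MinimalZeroSumℤ a y × (∀ i → y i ≢ + 0)
  collinear-vertical D≡0 x₀≡0 = (y-sum , y-minimal) , λ i → no-zero-column i (x≡0 i)
    where
    y₀≢0 : y 0F ≢ + 0
    y₀≢0 = no-zero-column 0F x₀≡0
    x≡0 : ∀ i → x i ≡ + 0
    x≡0 = fin3 x₀≡0
      (factor≡0 (x 1F) (trans (≡.sym (cross (D≡0 2F))) (cong (_* y 1F) x₀≡0)) y₀≢0)
      (factor≡0 (x 2F) (trans (≡.sym (cross′ (D≡0 1F))) (cong (_* y 2F) x₀≡0)) y₀≢0)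
    y-minimal : ∀ j → (∀ i → j i ≤ a i) → (∃[ i ] 1 ≤ j i) → (∃[ i ] j i ≢ a i) → combination j y ≢ + 0
    y-minimal j le ne pr = no-proper-zero-subsum j le ne pr (trans (combination-cong j x≡0) (combination-zero j))

  collinear-oblique : (∀ i → D i ≡ + 0) → x 0F ≢ + 0 → MinimalZeroSumℤ a x × (∀ i → x i ≢ + 0)
  collinear-oblique D≡0 x₀≢0 = (x-sum , x-minimal) , fin3 x₀≢0 x₁≢0 x₂≢0
    where
    x₁≢0 : x 1F ≢ + 0
    x₁≢0 x₁≡0 = no-zero-column 1F x₁≡0
      (factor≡0 (y 1F) (trans (≡.sym (*-comm (x 0F) (y 1F))) (trans (cross (D≡0 2F)) (cong (_* y 0F) x₁≡0))) x₀≢0)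
    x₂≢0 : x 2F ≢ + 0
    x₂≢0 x₂≡0 = no-zero-column 2F x₂≡0
      (factor≡0 (y 2F) (trans (≡.sym (*-comm (x 0F) (y 2F))) (trans (cross′ (D≡0 1F)) (cong (_* y 0F) x₂≡0))) x₀≢0)
    forced : ∀ j → combination j x ≡ + 0 → combination j y ≡ + 0
    forced j ex = factor≡0 (combination j y) (trans (*-comm _ (x 0F)) (begin
      x 0F * combination j y
        ≡⟨ identity (+ j 0F) (+ j 1F) (+ j 2F) (x 0F) (x 1F) (x 2F) (y 0F) (y 1F) (y 2F) ⟩
      y 0F * combination j x + (+ j 1F * D 2F + + j 2F * D 1F)
        ≡⟨ cong₃ (λ s t u → y 0F * s + (+ j 1F * t + + j 2F * u)) ex (D≡0 2F) (D≡0 1F) ⟩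
      y 0F * + 0 + (+ j 1F * + 0 + + j 2F * + 0)
        ≡⟨ vanish (y 0F) (+ j 1F) (+ j 2F) ⟩
      + 0 ∎)) x₀≢0
      where
      open ≡.≡-Reasoning
      identity : ∀ j₀ j₁ j₂ x₀ x₁ x₂ y₀ y₁ y₂ → x₀ * (j₀ * y₀ + (j₁ * y₁ + j₂ * y₂)) ≡
        y₀ * (j₀ * x₀ + (j₁ * x₁ + j₂ * x₂)) + (j₁ * (x₀ * y₁ - x₁ * y₀) + j₂ * (x₀ * y₂ - x₂ * y₀))
      identity = solve-∀
      vanish : ∀ u v w → u * + 0 + (v * + 0 + w * + 0) ≡ + 0
      vanish = solve-∀
    x-minimal : ∀ j → (∀ i → j i ≤ a i) → (∃[ i ] 1 ≤ j i) → (∃[ i ] j i ≢ a i) → combination j x ≢ + 0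
    x-minimal j le ne pr ex = no-proper-zero-subsum j le ne pr ex (forced j ex)

  collinear⇒len≤oneDimBound : ∀ {n} → Over (suc n) S → (∀ i → D i ≡ + 0) → len S ≤ oneDimBound n
  collinear⇒len≤oneDimBound over D≡0 with x 0F ≟ + 0
  ... | yes x₀≡0 = let min-y , y≢0 = collinear-vertical D≡0 x₀≡0 in
    oneDim-bound y (multPos S) y≢0 (λ i → InRange⇒∣∣≤ (proj₂ (over i))) min-y
  ... | no x₀≢0 = let min-x , x≢0 = collinear-oblique D≡0 x₀≢0 in
    oneDim-bound x (multPos S) x≢0 (λ i → InRange⇒∣∣≤ (proj₁ (over i))) min-x

module Extremal (k : ℕ) where
  open import Data.Integer using (ℤ; +_; -_; _+_; _-_; _*_; +≤+; -≤+)
  open import Data.Integer.Properties using (+-injective; neg-injective; pos-+; pos-*; ≤-refl; neg-distribʳ-*)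
  open import Data.Integer.Tactic.RingSolver using (solve-∀)
  open import Data.Nat using (suc; z≤n; s≤s)
  import Data.Nat.Properties as ℕₚ
  import Data.Nat.Tactic.RingSolver as ℕ-Solver
  open import Data.Nat.Coprimality using (Coprime; coprime-+; 1-coprimeTo; coprime-divisor)
  import Data.Nat.Coprimality as Coprimality
  open import Data.Nat.Divisibility using (divides; ∣⇒≤)
  open import Function.Definitions using (Injective)

  n : ℕ
  n = suc k

  b₀ b₁ b₂ : ℕ
  b₀ = suc (2 ℕ.* n)
  b₁ = suc b₂
  b₂ = 2 ℕ.* (n ℕ.* suc n)

  point : Fin 3 → Pt
  point = ⟨ (+ suc n , + n) , (- + suc n , + n) , (+ n , - + suc n) ⟩

  multiplicity : Fin 3 → ℕ
  multiplicity = ⟨ b₀ , b₁ , b₂ ⟩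

  private
    N : ℤ
    N = + n

    +b₂ : + b₂ ≡ + 2 * (N * (+ 1 + N))
    +b₂ = trans (pos-* 2 (n ℕ.* suc n)) (cong (λ t → + 2 * t) (pos-* n (suc n)))

    +b₁ : + b₁ ≡ + 1 + + 2 * (N * (+ 1 + N))
    +b₁ = trans (pos-+ 1 b₂) (cong (λ t → + 1 + t) +b₂)

    +b₀ : + b₀ ≡ + 1 + + 2 * N
    +b₀ = trans (pos-+ 1 (2 ℕ.* n)) (cong (λ t → + 1 + t) (pos-* 2 n))

  zero-sum : wsum multiplicity point ≡ 0ᵖ
  zero-sum = cong₂ _,_
    (trans (cong₃ (λ u v w → u * (+ 1 + N) + (v * - (+ 1 + N) + w * N)) +b₀ +b₁ +b₂) (identityˣ N))
    (trans (cong₃ (λ u v w → u * N + (v * N + w * - (+ 1 + N))) +b₀ +b₁ +b₂) (identityʸ N))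
    where
    identityˣ : ∀ N → (+ 1 + + 2 * N) * (+ 1 + N) + ((+ 1 + + 2 * (N * (+ 1 + N))) * - (+ 1 + N) +
                      (+ 2 * (N * (+ 1 + N))) * N) ≡ + 0
    identityˣ = solve-∀
    identityʸ : ∀ N → (+ 1 + + 2 * N) * N + ((+ 1 + + 2 * (N * (+ 1 + N))) * N +
                      (+ 2 * (N * (+ 1 + N))) * - (+ 1 + N)) ≡ + 0
    identityʸ = solve-∀

  detDel-point₀ : detDel point 0F ≡ + b₀
  detDel-point₀ = trans (identity N) (≡.sym +b₀)
    where
    identity : ∀ N → (- (+ 1 + N)) * - (+ 1 + N) - N * N ≡ + 1 + + 2 * N
    identity = solve-∀

  detDel-point₁ : detDel point 1F ≡ - + b₁
  detDel-point₁ = trans (identity N) (cong -_ (≡.sym +b₁))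
    where
    identity : ∀ N → (+ 1 + N) * - (+ 1 + N) - N * N ≡ - (+ 1 + + 2 * (N * (+ 1 + N)))
    identity = solve-∀

  detDel-point₂ : detDel point 2F ≡ + b₂
  detDel-point₂ = trans (identity N) (≡.sym +b₂)
    where
    identity : ∀ N → (+ 1 + N) * N - (- (+ 1 + N)) * N ≡ + 2 * (N * (+ 1 + N))
    identity = solve-∀

  private
    ℕ-equation : ∀ A B c d → + A * + c ≡ + B * + d → A ℕ.* c ≡ B ℕ.* d
    ℕ-equation A B c d e = +-injective (trans (pos-* A c) (trans e (≡.sym (pos-* B d))))

    ℕ-equation⁻ : ∀ A B c d → + A * - + c ≡ + B * - + d → A ℕ.* c ≡ B ℕ.* d
    ℕ-equation⁻ A B c d e = ℕ-equation A B c d (neg-injective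
      (trans (neg-distribʳ-* (+ A) (+ c)) (trans e (≡.sym (neg-distribʳ-* (+ B) (+ d))))))

    coprime-b₂-b₁ : Coprime b₂ b₁
    coprime-b₂-b₁ = Coprimality.sym (subst (λ t → Coprime t b₂) (ℕₚ.+-comm b₂ 1) (coprime-+ (1-coprimeTo b₂)))

    ∣∧≤⇒≡0⊎≡ : ∀ {d x} → d ∣ x → x ≤ d → x ≡ 0 ⊎ x ≡ d
    ∣∧≤⇒≡0⊎≡ {x = 0}     _   _   = inj₁ refl
    ∣∧≤⇒≡0⊎≡ {x = suc _} d∣x x≤d = inj₂ (ℕₚ.≤-antisym x≤d (∣⇒≤ d∣x))

  cramer-relations : ∀ j → wsum j point ≡ 0ᵖ → (j 2F ℕ.* b₁ ≡ j 1F ℕ.* b₂) × (j 2F ℕ.* b₀ ≡ j 0F ℕ.* b₂)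
  cramer-relations j e =
    ℕ-equation⁻ (j 2F) (j 1F) b₁ b₂
      (≡.subst₂ (λ s t → + j 2F * s ≡ + j 1F * - t) detDel-point₁ detDel-point₂ cramer₁₂) ,
    ℕ-equation (j 2F) (j 0F) b₀ b₂
      (≡.subst₂ (λ s t → + j 2F * s ≡ + j 0F * t) detDel-point₀ detDel-point₂ cramer₀₂)
    where open Cramer point j e

  -- b₂ and b₁ = b₂ + 1 are coprime, so b₂ ∣ j₂ ≤ b₂ pins down j₂ and with it the whole of j.
  zero-subsum-trivial : ∀ j → (∀ i → j i ≤ multiplicity i) → wsum j point ≡ 0ᵖ →
                        (∀ i → j i ≡ 0) ⊎ (∀ i → j i ≡ multiplicity i)
  zero-subsum-trivial j j≤ e = by-j₂ (∣∧≤⇒≡0⊎≡ b₂∣j₂ (j≤ 2F))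
    where
    j₂b₁≡j₁b₂ : j 2F ℕ.* b₁ ≡ j 1F ℕ.* b₂
    j₂b₁≡j₁b₂ = proj₁ (cramer-relations j e)
    j₂b₀≡j₀b₂ : j 2F ℕ.* b₀ ≡ j 0F ℕ.* b₂
    j₂b₀≡j₀b₂ = proj₂ (cramer-relations j e)
    b₂∣j₂ : b₂ ∣ j 2F
    b₂∣j₂ = coprime-divisor coprime-b₂-b₁ (divides (j 1F) (trans (ℕₚ.*-comm b₁ (j 2F)) j₂b₁≡j₁b₂))
    by-j₂ : j 2F ≡ 0 ⊎ j 2F ≡ b₂ → (∀ i → j i ≡ 0) ⊎ (∀ i → j i ≡ multiplicity i)
    by-j₂ (inj₁ j₂≡0) = inj₁ (fin3
      (ℕₚ.m*n≡0⇒m≡0 (j 0F) b₂ (trans (≡.sym j₂b₀≡j₀b₂) (cong (ℕ._* b₀) j₂≡0)))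
      (ℕₚ.m*n≡0⇒m≡0 (j 1F) b₂ (trans (≡.sym j₂b₁≡j₁b₂) (cong (ℕ._* b₁) j₂≡0)))
      j₂≡0)
    by-j₂ (inj₂ j₂≡b₂) = inj₂ (fin3
      (ℕₚ.*-cancelʳ-≡ (j 0F) b₀ b₂ (trans (≡.sym j₂b₀≡j₀b₂) (trans (cong (ℕ._* b₀) j₂≡b₂) (ℕₚ.*-comm b₂ b₀))))
      (ℕₚ.*-cancelʳ-≡ (j 1F) b₁ b₂ (trans (≡.sym j₂b₁≡j₁b₂) (trans (cong (ℕ._* b₁) j₂≡b₂) (ℕₚ.*-comm b₂ b₁))))
      j₂≡b₂)

  point-injective : Injective _≡_ _≡_ point
  point-injective {0F} {0F} _ = refl
  point-injective {0F} {1F} e = case cong proj₁ e of λ ()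
  point-injective {0F} {2F} e = ⊥-elim (ℕₚ.1+n≢n (+-injective (cong proj₁ e)))
  point-injective {1F} {0F} e = case cong proj₁ e of λ ()
  point-injective {1F} {1F} _ = refl
  point-injective {1F} {2F} e = case cong proj₁ e of λ ()
  point-injective {2F} {0F} e = ⊥-elim (ℕₚ.1+n≢n (≡.sym (+-injective (cong proj₁ e))))
  point-injective {2F} {1F} e = case cong proj₁ e of λ ()
  point-injective {2F} {2F} _ = refl

  extremal : Seq3
  extremal = record
    { pt       = point
    ; mult     = multiplicity
    ; distinct = point-injective
    ; multPos  = fin3 (s≤s z≤n) (s≤s z≤n) (s≤s z≤n)
    }

  over : Over (suc n) extremal
  over = fin3 (top , middle) (bottom , middle) (middle , bottom)
    where
    top : InRange (suc n) (+ suc n)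
    top = -≤+ , ≤-refl
    middle : InRange (suc n) (+ n)
    middle = -≤+ , +≤+ (ℕₚ.n≤1+n n)
    bottom : InRange (suc n) (- + suc n)
    bottom = ≤-refl , -≤+

  minimal : MinZeroSum extremal
  minimal = zero-sum , λ j j≤ (i , j≥1) (i′ , j≢) e → case zero-subsum-trivial j j≤ e of λ where
    (inj₁ j≡0) → 1≤⇒0≢ j≥1 (≡.sym (j≡0 i))
    (inj₂ j≡b) → j≢ (j≡b i′)

  length : len extremal ≡ extremalLength n
  length = identity n
    where
    identity : ∀ n → suc (2 ℕ.* n) ℕ.+ suc (2 ℕ.* (n ℕ.* suc n)) ℕ.+ 2 ℕ.* (n ℕ.* suc n)
                     ≡ suc n ℕ.* (4 ℕ.* n ℕ.+ 2)
    identity = ℕ-Solver.solve-∀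

  extremalLength≤ : ∀ {L} → IsD3 (suc n) L → extremalLength n ≤ L
  extremalLength≤ {L} d₃ = subst (_≤ L) length (proj₂ d₃ extremal over minimal)

module Extremality (q : ℕ) (S : Seq3) (over : Over (3 ℕ.+ q) S) (min : MinZeroSum S)
                   (long : extremalLength (2 ℕ.+ q) ≤ len S) where
  open import Data.Integer using (ℤ; +_; ∣_∣)
  import Data.Integer as ℤ
  open import Data.Integer.Properties using (∣i∣≡0⇒i≡0; abs-*)
  open import Data.Nat using (suc; z≤n; s≤s)
  import Data.Nat.Properties as ℕₚ
  import Data.Nat.Tactic.RingSolver as ℕ-Solver
  import Data.Sum as Sum
  open Signs
  open IntegerSigns
  open Determinants
  open OneDimensional using (combination; one-signed-zero-combination)
  open MinimalSequence S min

  n m : ℕ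
  n = 2 ℕ.+ q
  m = 3 ℕ.+ q

  not-collinear : ¬ (∀ i → D i ≡ + 0)
  not-collinear D≡0 =
    ℕₚ.<⇒≱ (oneDimBound<extremalLength n) (ℕₚ.≤-trans long (collinear⇒len≤oneDimBound over D≡0))

  no-multiple≥2 : ∀ t → ¬ (∀ i → ∣ D i ∣ ≡ suc (suc t) ℕ.* a i)
  no-multiple≥2 t e = ℕₚ.<⇒≱ (3·detBound<2·extremalLength q) (begin
    2 ℕ.* extremalLength n                 ≤⟨ ℕₚ.*-monoʳ-≤ 2 long ⟩
    2 ℕ.* len S                            ≤⟨ ℕₚ.*-monoˡ-≤ (len S) (s≤s (s≤s (z≤n {t}))) ⟩
    suc (suc t) ℕ.* len S                  ≡⟨ distribute (suc (suc t)) (a 0F) (a 1F) (a 2F) ⟨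
    suc (suc t) ℕ.* a 0F ℕ.+ suc (suc t) ℕ.* a 1F ℕ.+ suc (suc t) ℕ.* a 2F
                                           ≡⟨ cong₃ (λ u v w → u ℕ.+ v ℕ.+ w) (e 0F) (e 1F) (e 2F) ⟨
    ∣ D 0F ∣ ℕ.+ ∣ D 1F ∣ ℕ.+ ∣ D 2F ∣     ≤⟨ ℕₚ.+-mono-≤ (ℕₚ.+-mono-≤ (bounded 1F 2F) (bounded 0F 2F))
                                                           (bounded 0F 1F) ⟩
    detBound m ℕ.+ detBound m ℕ.+ detBound m ∎)
    where
    open ℕₚ.≤-Reasoning
    distribute : ∀ t a₀ a₁ a₂ → t ℕ.* a₀ ℕ.+ t ℕ.* a₁ ℕ.+ t ℕ.* a₂ ≡ t ℕ.* (a₀ ℕ.+ a₁ ℕ.+ a₂)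
    distribute = ℕ-Solver.solve-∀
    bounded : ∀ i j → ∣ det2 (p i) (p j) ∣ ≤ detBound m
    bounded i j = ∣det2∣≤detBound (p i) (p j) (over i) (over j)

  ∣D∣≡mult : ∀ i → ∣ D i ∣ ≡ a i
  ∣D∣≡mult = by-multiple ∣det∣≡t*mult
    where
    by-multiple : ∃[ t ] (∀ i → ∣ D i ∣ ≡ t ℕ.* a i) → ∀ i → ∣ D i ∣ ≡ a i
    by-multiple (0 , e)           = ⊥-elim (not-collinear (λ i → ∣i∣≡0⇒i≡0 (e i)))
    by-multiple (1 , e)           = λ i → trans (e i) (ℕₚ.*-identityˡ (a i))
    by-multiple (suc (suc t) , e) = ⊥-elim (no-multiple≥2 t e)

  len≡∣doubleArea∣ : len S ≡ ∣ doubleArea p ∣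
  len≡∣doubleArea∣ = ℕₚ.*-cancelʳ-≡ (len S) ∣ doubleArea p ∣ (a 0F) {{ℕ.>-nonZero (multPos S 0F)}} (begin
    len S ℕ.* a 0F               ≡⟨ cong (len S ℕ.*_) (∣D∣≡mult 0F) ⟨
    len S ℕ.* ∣ D 0F ∣           ≡⟨ abs-* (+ len S) (D 0F) ⟨
    ∣ + len S ℤ.* D 0F ∣         ≡⟨ cong ∣_∣ sum₃·D₀ ⟩
    ∣ + a 0F ℤ.* doubleArea p ∣  ≡⟨ abs-* (+ a 0F) (doubleArea p) ⟩
    a 0F ℕ.* ∣ doubleArea p ∣    ≡⟨ ℕₚ.*-comm (a 0F) ∣ doubleArea p ∣ ⟩
    ∣ doubleArea p ∣ ℕ.* a 0F    ∎)
    where open ≡.≡-Reasoning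

  D₂≢0 : D 2F ≢ + 0
  D₂≢0 D₂≡0 = 1≤⇒0≢ (multPos S 2F) (trans (≡.sym (cong ∣_∣ D₂≡0)) (∣D∣≡mult 2F))

  coordinate-zero : ∀ z → combination a z ≡ + 0 → T (allSigns nonNeg z) ⊎ T (allSigns nonPos z) → ∀ i → z i ≡ + 0
  coordinate-zero z zero-sum h = one-signed-zero-combination (multPos S) zero-sum
    (Sum.map (λ h i → nonNeg-sound (z i) (allSigns-sound nonNeg z h i))
             (λ h i → nonPos-sound (z i) (allSigns-sound nonPos z h i)) h)

  x-not-one-signed : ¬ T (oneSignedCoordinate proj₁ (configOf p))
  x-not-one-signed h = D₂≢0 (det2≡0-if-first≡0 (p 0F) (p 1F) (x≡0 0F) (x≡0 1F))
    where
    x≡0 : ∀ i → x i ≡ + 0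
    x≡0 = coordinate-zero x x-sum (Equivalence.to (T-∨ {allSigns nonNeg x}) h)

  y-not-one-signed : ¬ T (oneSignedCoordinate proj₂ (configOf p))
  y-not-one-signed h = D₂≢0 (det2≡0-if-second≡0 (p 0F) (p 1F) (y≡0 0F) (y≡0 1F))
    where
    y≡0 : ∀ i → y i ≡ + 0
    y≡0 = coordinate-zero y y-sum (Equivalence.to (T-∨ {allSigns nonNeg y}) h)

  not-two-in-one-quadrant : ¬ T (twoInOneQuadrant (configOf p))
  not-two-in-one-quadrant h = ℕₚ.<⇒≱ (sameQuadrantBound<extremalLength n)
    (ℕₚ.≤-trans long (subst (_≤ sameQuadrantBound n) (≡.sym len≡∣doubleArea∣) (∣doubleArea∣≤ n p over pair)))
    where
    pair : SameQuadrant (p 0F) (p 1F) ⊎ SameQuadrant (p 0F) (p 2F) ⊎ SameQuadrant (p 1F) (p 2F)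
    pair = Sum.map (sameOpenQuadrant-sound (p 0F) (p 1F))
      (Sum.map (sameOpenQuadrant-sound (p 0F) (p 2F)) (sameOpenQuadrant-sound (p 1F) (p 2F))
        ∘ Equivalence.to (T-∨ {sameOpenQuadrant (signᵖ (p 0F)) (signᵖ (p 2F))}))
      (Equivalence.to (T-∨ {sameOpenQuadrant (signᵖ (p 0F)) (signᵖ (p 1F))}) h)

  not-degenerate : ¬ T (degenerate (configOf p))
  not-degenerate =
    [ x-not-one-signed , [ y-not-one-signed , not-two-in-one-quadrant ]′
                         ∘ Equivalence.to (T-∨ {oneSignedCoordinate proj₂ (configOf p)}) ]′
    ∘ Equivalence.to (T-∨ {oneSignedCoordinate proj₁ (configOf p)})

  Conclusion : Set
  Conclusion = ∃[ B ] (Analogous p B × inC′ m B × len S ≡ sumAbsDet B)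

  normal-form : ∀ d → T (patternC′ (normalise d (columns (configOf p)))) → Conclusion
  normal-form (k , s , nx , ny) fits =
    B , analogous , ((box , nonzero , Δ≡1) , patternC′-sound B sign-pattern) , length
    where
    B : Mat
    B = sym s nx ny ∘ p ∘ apply k
    analogous : Analogous p B
    analogous = toPermutation k , s , nx , ny , λ i → refl
    ∣detDel-B∣ : ∀ i → ∣ detDel B i ∣ ≡ a (apply k i)
    ∣detDel-B∣ i =
      trans (∣detDel∣-sym s nx ny (p ∘ apply k) i) (trans (∣detDel∣-apply k p i) (∣D∣≡mult (apply k i)))
    box : ∀ i → InBox m (B i)
    box i = InBox-sym s nx ny (over (apply k i))
    nonzero : ∀ i → detDel B i ≢ + 0
    nonzero i e = 1≤⇒0≢ (multPos S (apply k i)) (trans (≡.sym (cong ∣_∣ e)) (∣detDel-B∣ i))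
    g : ℕ
    g = gcd₃ (∣_∣ ∘ detDel B)
    g∣a : ∀ j → g ∣ a j
    g∣a j = subst (λ i → g ∣ a i) (apply-inverseʳ k j)
                  (subst (g ∣_) (∣detDel-B∣ (apply (inverse k) j)) (gcd₃∣ (∣_∣ ∘ detDel B) (apply (inverse k) j)))
    Δ≡1 : Δ B ≡ + 1
    Δ≡1 = cong +_ (mult-coprime g (g∣a 0F) (g∣a 1F) (g∣a 2F))
    sign-pattern : T (patternC′ (signᵖ ∘ B))
    sign-pattern = subst T (patternC′-cong λ i → trans (cong (symˢ s nx ny) (columns-configOf p (apply k i)))
                                                (≡.sym (signᵖ-sym s nx ny (p (apply k i))))) fits
    length : len S ≡ sumAbsDet B
    length = ≡.sym (trans (cong₃ (λ u v w → u ℕ.+ v ℕ.+ w) (∣detDel-B∣ 0F) (∣detDel-B∣ 1F) (∣detDel-B∣ 2F))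
                          (sum₃-apply k a))

  result : Conclusion
  result = [ ⊥-elim ∘ not-degenerate , normalised ]′ (degenerate-or-normalisable (configOf p))
    where
    normalised : T (normalisable (configOf p)) → Conclusion
    normalised h = uncurry normal-form
      (satisfied (any⁻ (λ d → patternC′ (normalise d (columns (configOf p)))) normalisations h))

lemma20 : (m : ℕ) → 3 ≤ m → (S : Seq3) → Over m S → MinZeroSum S →
          IsD3 m (len S) →
          ∃[ B ] (Analogous (pt S) B × inC′ m B × len S ≡ sumAbsDet B)
lemma20 (ℕ.suc (ℕ.suc (ℕ.suc q))) (ℕ.s≤s (ℕ.s≤s (ℕ.s≤s _))) S over min d₃ =
  Extremality.result q S over min (Extremal.extremalLength≤ (ℕ.suc q) d₃)
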